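{- For $n\ge1$ define posets as follows. Let $r_i,\ell_i,q_i$ ($i=1,\ldots,n$) be $3n$ distinct elements and let $A_n$ be the poset on them generated by the relations $r_i<\ell_i$, $r_i<q_i$ ($1\le i\le n$) and $q_i<\ell_{i+1}$ ($1\le i\le n-1$). Let $E_n$ be $A_n$ together with a new element $e$ and the extra relation $q_n<e$; let $S_n$ be $A_n$ together with a new element $s$ and the extra relation $s<\ell_1$; let $B_n$ be $A_n$ together with both new elements $s,e$ and both extra relations $s<\ell_1$, $q_n<e$. For $W\in\{A,E,S,B\}$ let $\mathrm{LW}_n$ be the number of linear extensions of $W_n$, and set $\mathrm{LA}_0=\mathrm{LE}_0=\mathrm{LS}_0=\mathrm{LB}_0=1$. Then for all $n\ge1$: $$\mathrm{LB}_n=\mathrm{LE}_n+\sum_{k=1}^n\binom{3n+1}{3(k-1)+2}\mathrm{LB}_{k-1}\mathrm{LB}_{n-k},$$ $$\mathrm{LS}_n=\mathrm{LA}_n+\sum_{k=1}^n\binom{3n}{3(k-1)+2}\mathrm{LB}_{k-1}\mathrm{LS}_{n-k},$$ $$\mathrm{LE}_n=\sum_{k=1}^n\binom{3n}{3(k-1)+1}\mathrm{LE}_{k-1}\mathrm{LB}_{n-k},$$ $$\mathrm{LA}_n=\sum_{k=1}^n\binom{3n-1}{3(k-1)+1}\mathrm{LE}_{k-1}\mathrm{LS}_{n-k}.$$ Moreover $\mathrm{LA}_n$ equals the number $\mathrm{IAF}_n^2$ of forests $F=(F_1,\ldots,F_n)$ of $n$ binary shrubs with label set $\{1,\ldots,3n\}$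 satisfying $F_1<_A F_2<_A\cdots<_A F_n$.
   Context: In $A_n$, $r_i,\ell_i,q_i$ represent the root, left child and right child of the $i$-th binary shrub. A linear extension of a finite poset $P$ with $m$ elements is a bijective labeling of its elements by $\{1,\ldots,m\}$ that is order preserving. A binary shrub is a root with an ordered pair of children (left, right), labeled by distinct positive integers with the root's label smaller than both children's labels; its word is (root, left child, right child). A forest of $n$ binary shrubs with label set $\{1,\ldots,3n\}$ is an ordered sequence of $n$ binary shrubs whose labels together are exactly $\{1,\ldots,3n\}$, each used once. For shrubs with words $abc$ and $def$, $abc<_A def$ means $c<e$. -}

module Defs where

open import Data.Nat using (ℕ; zero; suc; _+_; _*_; _∸_; _<ᵇ_; _≡ᵇ_)
open import Data.Nat.Combinatorics public using (_C_)
open import Data.Bool using (Bool; true; false; _∧_; if_then_else_)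
open import Data.List using (List; []; _∷_; _++_; map; concatMap; filter; length; upTo)
open import Data.Bool.ListAction using (all; any)
open import Data.Nat.ListAction using (sum)
open import Data.Product using (_×_; _,_)
open import Function using (_∘_)
open import Relation.Nullary.Decidable using (does)
open import Data.Bool.Properties using (T?)

words : List ℕ → ℕ → List (List ℕ)
words vs zero    = [] ∷ []
words vs (suc k) = concatMap (λ v → map (v ∷_) (words vs k)) vs

labels : ℕ → List ℕ
labels m = map suc (upTo m)

elem : ℕ → List ℕ → Bool
elem x = any (x ≡ᵇ_)

-- a list of length m with entries in {1..m} containing every value of
-- {1..m}: i.e. a bijective labeling of the elements 0,…,m-1 by {1..m}
-- (element x receives label nth L x)
isBijLabeling : ℕ → List ℕ → Bool
isBijLabeling m L = all (λ v → elem v L) (labels m)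

bijLabelings : ℕ → List (List ℕ)
bijLabelings m = filter (λ L → T? (isBijLabeling m L)) (words (labels m) m)

nth : List ℕ → ℕ → ℕ
nth []       _       = 0
nth (x ∷ xs) zero    = x
nth (x ∷ xs) (suc i) = nth xs i

-- A poset on the elements 0,…,m-1 generated by a list of relations
-- (a , b) meaning a < b.  A labeling is order preserving for the
-- generated order iff it is order preserving on every generating relation.
record GenPoset : Set where
  constructor genPoset
  field
    size : ℕ
    rels : List (ℕ × ℕ)
open GenPoset public

preserves : List (ℕ × ℕ) → List ℕ → Bool
preserves rs L = all (λ { (a , b) → nth L a <ᵇ nth L b }) rs

numLinExt : GenPoset → ℕ
numLinExt P = length (filter (λ L → T? (preserves (rels P) L)) (bijLabelings (size P)))

r ℓ q : ℕ → ℕ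
r i = 3 * (i ∸ 1)
ℓ i = 3 * (i ∸ 1) + 1
q i = 3 * (i ∸ 1) + 2

idx : ℕ → List ℕ
idx n = map suc (upTo n)

relsA : ℕ → List (ℕ × ℕ)
relsA n = concatMap (λ i → (r i , ℓ i) ∷ (r i , q i) ∷ []) (idx n)
       ++ map (λ i → (q i , ℓ (suc i))) (idx (n ∸ 1))

posetA : ℕ → GenPoset
posetA n = genPoset (3 * n) (relsA n)

-- E_n : extra element e = 3n, relation q_n < e
posetE : ℕ → GenPoset
posetE n = genPoset (3 * n + 1) (relsA n ++ (q n , 3 * n) ∷ [])

-- S_n : extra element s = 3n, relation s < ℓ_1
posetS : ℕ → GenPoset
posetS n = genPoset (3 * n + 1) (relsA n ++ (3 * n , ℓ 1) ∷ [])

-- B_n : extra elements s = 3n, e = 3n+1, relations s < ℓ_1, q_n < e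
posetB : ℕ → GenPoset
posetB n = genPoset (3 * n + 2) (relsA n ++ (3 * n , ℓ 1) ∷ (q n , 3 * n + 1) ∷ [])

LA LE LS LB : ℕ → ℕ
LA zero = 1
LA n@(suc _) = numLinExt (posetA n)
LE zero = 1
LE n@(suc _) = numLinExt (posetE n)
LS zero = 1
LS n@(suc _) = numLinExt (posetS n)
LB zero = 1
LB n@(suc _) = numLinExt (posetB n)

-- A forest of n binary shrubs is encoded by the concatenation of the
-- words (root, left, right) of its shrubs, a list of length 3n.
-- Each shrub: root < left and root < right.
shrubsOK : List ℕ → Bool
shrubsOK []               = true
shrubsOK (a ∷ b ∷ c ∷ xs) = (a <ᵇ b) ∧ (a <ᵇ c) ∧ shrubsOK xs
shrubsOK _                = false

-- consecutive shrubs abc, def satisfy abc <_A def, i.e. c < e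
chainOK : List ℕ → Bool
chainOK (a ∷ b ∷ c ∷ xs@(d ∷ e ∷ f ∷ _)) = (c <ᵇ e) ∧ chainOK xs
chainOK _ = true

IAF2 : ℕ → ℕ
IAF2 n = length (filter (λ F → T? (shrubsOK F ∧ chainOK F)) (bijLabelings (3 * n)))

sumFrom1 : ℕ → (ℕ → ℕ) → ℕ
sumFrom1 n f = sum (map f (idx n))

-- Reading its elements in the order ℓ₁, r₁, q₁, ℓ₂, r₂, q₂, … shows that Aₙ is a zigzag (fence)
-- ℓ₁ > r₁ < q₁ < ℓ₂ > r₂ < ⋯ < qₙ, and so are Eₙ (e appended above qₙ), Sₙ (s prepended below ℓ₁)
-- and Bₙ (both). In a linear extension of a zigzag the label 1 sits at a valley, and removing the
-- valley leaves two unrelated zigzags whose linear extensions shuffle freely; summing over the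
-- position of the valley gives a binomial convolution. The valleys of these zigzags are s and the
-- roots rₖ, and the pieces on either side of them are again zigzags of the four kinds, which gives
-- the four recurrences. Finally the relations rₖ < ℓₖ, rₖ < qₖ say that each shrub is increasing and
-- qₖ < ℓₖ₊₁ is the condition Fₖ <_A Fₖ₊₁, so linear extensions of Aₙ are the forests counted by IAF².

module Submission where

open import Defs
open import Data.Bool using (Bool; true; false; _∧_; _∨_; not; if_then_else_; T)
open import Data.Bool.ListAction using (all; any)
open import Data.Bool.Properties using (T?; ∧-identityʳ; ∧-zeroʳ; ∨-identityʳ; ∨-zeroʳ; ∨-assoc)
open import Data.Empty using (⊥; ⊥-elim)
open import Data.List using (List; []; _∷_; _++_; _∷ʳ_; map; concatMap; filter; length; upTo)
open import Data.List.Properties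
  using (map-∘; map-++; map-cong; map-cong-local; map-id; map-id-local; map-upTo; length-map; length-++;
         length-upTo; upTo-∷ʳ; ++-assoc; ++-identityʳ)
open import Data.List.Relation.Binary.Permutation.Propositional as ↭ using (_↭_)
open import Data.List.Relation.Binary.Permutation.Propositional.Properties using (↭-length; shift; ∷↭∷ʳ; ++⁺ʳ)
import Data.List.Relation.Binary.Permutation.Propositional.Properties as ↭ using (++⁺)
open import Data.List.Relation.Unary.All as All using (All; []; _∷_)
open import Data.List.Relation.Unary.All.Properties using (map⁺; map⁻; ++⁺; all-upTo; filter⁺; applyUpTo⁺₁; applyUpTo⁻)
open import Data.Nat using (ℕ; zero; suc; _+_; _*_; _∸_; _≤_; _<_; z≤n; s≤s; _<ᵇ_; _≡ᵇ_)
open import Data.Nat.Combinatorics using (nCn≡1; nCk+nC[k+1]≡[n+1]C[k+1])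
open import Data.Nat.ListAction using (sum)
open import Data.Nat.ListAction.Properties using (sum-++)
open import Data.Nat.Properties
open import Algebra.Properties.CommutativeSemigroup +-commutativeSemigroup using (interchange; x∙yz≈y∙xz)
open import Algebra.Properties.CommutativeSemigroup *-commutativeSemigroup using (xy∙z≈xz∙y)
open import Data.Nat.Tactic.RingSolver using (solve-∀)
open import Data.Product using (_×_; _,_; proj₁; proj₂; Σ)
open import Data.Sum using (_⊎_; inj₁; inj₂)
open import Data.Unit using (⊤; tt)
open import Function using (_∘_; _on_; id)
open import Function.Bundles using (_⇔_; mk⇔; Equivalence)
open import Relation.Binary.Definitions using (Tri; tri<; tri≈; tri>)
open import Relation.Binary.PropositionalEquality

private variable
  A B : Set

bool-ext : {a b : Bool} → (a ≡ true → b ≡ true) → (b ≡ true → a ≡ true) → a ≡ b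
bool-ext {false} {false} _ _ = refl
bool-ext {false} {true}  _ g = g refl
bool-ext {true}  {false} f _ = sym (f refl)
bool-ext {true}  {true}  _ _ = refl

true≢false : {C : Set} {b : Bool} → b ≡ true → b ≡ false → C
true≢false refl ()

∧-≡true⁻ : ∀ {a b} → a ∧ b ≡ true → a ≡ true × b ≡ true
∧-≡true⁻ {true} {true} _ = refl , refl

∨-≡true⁻ : ∀ {a b} → a ∨ b ≡ true → a ≡ true ⊎ b ≡ true
∨-≡true⁻ {true}  _ = inj₁ refl
∨-≡true⁻ {false} e = inj₂ e

∨-≡false⁻ : ∀ {a b} → a ∨ b ≡ false → a ≡ false × b ≡ false
∨-≡false⁻ {false} {false} _ = refl , refl

∨-≡trueˡ : ∀ {a} b → a ≡ true → a ∨ b ≡ true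
∨-≡trueˡ b refl = refl

∨-≡trueʳ : ∀ a {b} → b ≡ true → a ∨ b ≡ true
∨-≡trueʳ a refl = ∨-zeroʳ a

not-≡true⁻ : ∀ {a} → not a ≡ true → a ≡ false
not-≡true⁻ {false} _ = refl

≡ᵇ-refl : ∀ n → (n ≡ᵇ n) ≡ true
≡ᵇ-refl zero    = refl
≡ᵇ-refl (suc n) = ≡ᵇ-refl n

≡⇒≡ᵇ-true : ∀ {a b} → a ≡ b → (a ≡ᵇ b) ≡ true
≡⇒≡ᵇ-true {a} refl = ≡ᵇ-refl a

≡ᵇ-true⇒≡ : ∀ a b → (a ≡ᵇ b) ≡ true → a ≡ b
≡ᵇ-true⇒≡ a b e = ≡ᵇ⇒≡ a b (subst T (sym e) tt)

≢⇒≡ᵇ-false : ∀ a b → a ≢ b → (a ≡ᵇ b) ≡ false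
≢⇒≡ᵇ-false zero    zero    ne = ⊥-elim (ne refl)
≢⇒≡ᵇ-false zero    (suc b) _  = refl
≢⇒≡ᵇ-false (suc a) zero    _  = refl
≢⇒≡ᵇ-false (suc a) (suc b) ne = ≢⇒≡ᵇ-false a b (ne ∘ cong suc)

<⇒≡ᵇ-false : ∀ {a b} → a < b → (a ≡ᵇ b) ≡ false
<⇒≡ᵇ-false {a} {b} a<b = ≢⇒≡ᵇ-false a b (<⇒≢ a<b)

>⇒≡ᵇ-false : ∀ {a b} → b < a → (a ≡ᵇ b) ≡ false
>⇒≡ᵇ-false {a} {b} b<a = ≢⇒≡ᵇ-false a b (>⇒≢ b<a)

<⇒<ᵇ-true : ∀ {a b} → a < b → (a <ᵇ b) ≡ true
<⇒<ᵇ-true {zero}  {suc b} _         = refl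
<⇒<ᵇ-true {suc a} {suc b} (s≤s a<b) = <⇒<ᵇ-true a<b

≥⇒<ᵇ-false : ∀ {a b} → b ≤ a → (a <ᵇ b) ≡ false
≥⇒<ᵇ-false {a}     {zero}  _         = refl
≥⇒<ᵇ-false {suc a} {suc b} (s≤s b≤a) = ≥⇒<ᵇ-false b≤a

<ᵇ-true⇒< : ∀ a b → (a <ᵇ b) ≡ true → a < b
<ᵇ-true⇒< a b e = <ᵇ⇒< a b (subst T (sym e) tt)

any-map : (p : B → Bool) (f : A → B) (xs : List A) → any p (map f xs) ≡ any (p ∘ f) xs
any-map p f []       = refl
any-map p f (x ∷ xs) = cong (p (f x) ∨_) (any-map p f xs)

all-map : (p : B → Bool) (f : A → B) (xs : List A) → all p (map f xs) ≡ all (p ∘ f) xs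
all-map p f []       = refl
all-map p f (x ∷ xs) = cong (p (f x) ∧_) (all-map p f xs)

any-++ : (p : A → Bool) (xs ys : List A) → any p (xs ++ ys) ≡ any p xs ∨ any p ys
any-++ p []       ys = refl
any-++ p (x ∷ xs) ys = trans (cong (p x ∨_) (any-++ p xs ys)) (sym (∨-assoc (p x) _ _))

any-concatMap : (p : B → Bool) (f : A → List B) (xs : List A) →
                any p (concatMap f xs) ≡ any (any p ∘ f) xs
any-concatMap p f []       = refl
any-concatMap p f (x ∷ xs) = trans (any-++ p (f x) (concatMap f xs)) (cong (any p (f x) ∨_) (any-concatMap p f xs))

any-cong : {p q : A → Bool} (xs : List A) → All (λ x → p x ≡ q x) xs → any p xs ≡ any q xs
any-cong []       []       = refl
any-cong (x ∷ xs) (e ∷ es) = cong₂ _∨_ e (any-cong xs es)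

all-cong : {p q : A → Bool} (xs : List A) → (∀ x → p x ≡ q x) → all p xs ≡ all q xs
all-cong []       e = refl
all-cong (x ∷ xs) e = cong₂ _∧_ (e x) (all-cong xs e)

any-false : (p : A → Bool) (xs : List A) → All (λ x → p x ≡ false) xs → any p xs ≡ false
any-false p []       []       = refl
any-false p (x ∷ xs) (e ∷ es) rewrite e = any-false p xs es

all-true⁻ : (p : A → Bool) (xs : List A) → all p xs ≡ true → All (λ x → p x ≡ true) xs
all-true⁻ p []       _ = []
all-true⁻ p (x ∷ xs) h = proj₁ (∧-≡true⁻ h) ∷ all-true⁻ p xs (proj₂ (∧-≡true⁻ {p x} h))

all-true⁺ : (p : A → Bool) (xs : List A) → All (λ x → p x ≡ true) xs → all p xs ≡ true
all-true⁺ p []       []       = refl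
all-true⁺ p (x ∷ xs) (e ∷ es) rewrite e = all-true⁺ p xs es

upTo-suc : ∀ n → upTo (suc n) ≡ 0 ∷ map suc (upTo n)
upTo-suc n = cong (0 ∷_) (sym (map-upTo suc n))

all-upTo⁻ : (p : ℕ → Bool) (n : ℕ) → all p (upTo n) ≡ true → ∀ a → a < n → p a ≡ true
all-upTo⁻ p n h a = applyUpTo⁻ id n (all-true⁻ p (upTo n) h)

all-upTo⁺ : (p : ℕ → Bool) (n : ℕ) → (∀ a → a < n → p a ≡ true) → all p (upTo n) ≡ true
all-upTo⁺ p n h = all-true⁺ p (upTo n) (applyUpTo⁺₁ id n (h _))

any-upTo-false⁺ : (p : ℕ → Bool) (n : ℕ) → (∀ a → a < n → p a ≡ false) → any p (upTo n) ≡ false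
any-upTo-false⁺ p n h = any-false p (upTo n) (applyUpTo⁺₁ id n (h _))

any-upTo-false⁻ : (p : ℕ → Bool) (n : ℕ) → any p (upTo n) ≡ false → ∀ a → a < n → p a ≡ false
any-upTo-false⁻ p (suc n) h a a<n with subst (λ l → any p l ≡ false) (upTo-suc n) h
any-upTo-false⁻ p (suc n) h zero    _         | h′ = proj₁ (∨-≡false⁻ h′)
any-upTo-false⁻ p (suc n) h (suc a) (s≤s a<n) | h′ =
  any-upTo-false⁻ (p ∘ suc) n (trans (sym (any-map p suc (upTo n))) (proj₂ (∨-≡false⁻ {p 0} h′))) a a<n

any-upTo⁻ : (p : ℕ → Bool) (n : ℕ) → any p (upTo n) ≡ true → Σ ℕ (λ t → t < n × p t ≡ true)
any-upTo⁻ p (suc n) h with p 0 in e | subst (λ l → any p l ≡ true) (upTo-suc n) h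
... | true  | _  = 0 , s≤s z≤n , e
... | false | h′ with any-upTo⁻ (p ∘ suc) n (trans (sym (any-map p suc (upTo n))) h′)
... | t , t<n , pt = suc t , s≤s t<n , pt

any-upTo⁺ : (p : ℕ → Bool) (n t : ℕ) → t < n → p t ≡ true → any p (upTo n) ≡ true
any-upTo⁺ p (suc n) zero    _         e = subst (λ l → any p l ≡ true) (sym (upTo-suc n)) (∨-≡trueˡ _ e)
any-upTo⁺ p (suc n) (suc t) (s≤s t<n) e = subst (λ l → any p l ≡ true) (sym (upTo-suc n))
  (∨-≡trueʳ (p 0) (trans (any-map p suc (upTo n)) (any-upTo⁺ (p ∘ suc) n t t<n e)))

[_]ᵇ : Bool → ℕ
[ b ]ᵇ = if b then 1 else 0

count : (A → Bool) → List A → ℕ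
count p []       = 0
count p (x ∷ xs) = [ p x ]ᵇ + count p xs

length-filter : (p : A → Bool) (xs : List A) → length (filter (T? ∘ p) xs) ≡ count p xs
length-filter p []       = refl
length-filter p (x ∷ xs) with p x
... | true  = cong suc (length-filter p xs)
... | false = length-filter p xs

count-filter : (p q : A → Bool) (xs : List A) → count p (filter (T? ∘ q) xs) ≡ count (λ x → q x ∧ p x) xs
count-filter p q []       = refl
count-filter p q (x ∷ xs) with q x
... | true  = cong ([ p x ]ᵇ +_) (count-filter p q xs)
... | false = count-filter p q xs

count-++ : (p : A → Bool) (xs ys : List A) → count p (xs ++ ys) ≡ count p xs + count p ys
count-++ p []       ys = refl
count-++ p (x ∷ xs) ys = trans (cong ([ p x ]ᵇ +_) (count-++ p xs ys)) (sym (+-assoc [ p x ]ᵇ _ _))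

count-map : (p : B → Bool) (f : A → B) (xs : List A) → count p (map f xs) ≡ count (p ∘ f) xs
count-map p f []       = refl
count-map p f (x ∷ xs) = cong ([ p (f x) ]ᵇ +_) (count-map p f xs)

count-cong : {p q : A → Bool} (xs : List A) → All (λ x → p x ≡ q x) xs → count p xs ≡ count q xs
count-cong []       []       = refl
count-cong (x ∷ xs) (e ∷ es) = cong₂ (λ a b → [ a ]ᵇ + b) e (count-cong xs es)

count-∧ˡ : (b : Bool) (p : A → Bool) (xs : List A) → count (λ x → b ∧ p x) xs ≡ (if b then count p xs else 0)
count-∧ˡ true  p xs       = refl
count-∧ˡ false p []       = refl
count-∧ˡ false p (x ∷ xs) = count-∧ˡ false p xs

count-false : (p : A → Bool) (xs : List A) → (∀ x → p x ≡ false) → count p xs ≡ 0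
count-false p []       h = refl
count-false p (x ∷ xs) h rewrite h x = count-false p xs h

sum-map-∘ : (f : B → ℕ) (g : A → B) (xs : List A) → sum (map f (map g xs)) ≡ sum (map (f ∘ g) xs)
sum-map-∘ f g xs = cong sum (sym (map-∘ xs))

sum-map-0 : (xs : List A) → sum (map (λ _ → 0) xs) ≡ 0
sum-map-0 []       = refl
sum-map-0 (x ∷ xs) = sum-map-0 xs

sum-map-+ : (f g : A → ℕ) (xs : List A) → sum (map (λ x → f x + g x) xs) ≡ sum (map f xs) + sum (map g xs)
sum-map-+ f g []       = refl
sum-map-+ f g (x ∷ xs) = trans (cong (f x + g x +_) (sum-map-+ f g xs)) (interchange (f x) (g x) _ _)

sum-map-*ˡ : (c : ℕ) (f : A → ℕ) (xs : List A) → sum (map (λ x → c * f x) xs) ≡ c * sum (map f xs)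
sum-map-*ˡ c f []       = sym (*-zeroʳ c)
sum-map-*ˡ c f (x ∷ xs) = trans (cong (c * f x +_) (sum-map-*ˡ c f xs)) (sym (*-distribˡ-+ c (f x) _))

count-concatMap : (p : B → Bool) (f : A → List B) (xs : List A) →
                  count p (concatMap f xs) ≡ sum (map (count p ∘ f) xs)
count-concatMap p f []       = refl
count-concatMap p f (x ∷ xs) = trans (count-++ p (f x) (concatMap f xs)) (cong (count p (f x) +_) (count-concatMap p f xs))

sum-upTo-suc : (f : ℕ → ℕ) (n : ℕ) → sum (map f (upTo (suc n))) ≡ f 0 + sum (map (f ∘ suc) (upTo n))
sum-upTo-suc f n = trans (cong (sum ∘ map f) (upTo-suc n)) (cong (f 0 +_) (sum-map-∘ f suc (upTo n)))

sum-upTo-sucʳ : (f : ℕ → ℕ) (n : ℕ) → sum (map f (upTo (suc n))) ≡ sum (map f (upTo n)) + f n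
sum-upTo-sucʳ f n = begin
  sum (map f (upTo (suc n)))             ≡⟨ cong (sum ∘ map f) (upTo-∷ʳ n) ⟨
  sum (map f (upTo n ++ n ∷ []))         ≡⟨ cong sum (map-++ f (upTo n) (n ∷ [])) ⟩
  sum (map f (upTo n) ++ f n ∷ [])       ≡⟨ sum-++ (map f (upTo n)) (f n ∷ []) ⟩
  sum (map f (upTo n)) + (f n + 0)       ≡⟨ cong (sum (map f (upTo n)) +_) (+-identityʳ (f n)) ⟩
  sum (map f (upTo n)) + f n             ∎
  where open ≡-Reasoning

count-words-suc : (U : List ℕ) (m : ℕ) (p : List ℕ → Bool) →
                  count p (words U (suc m)) ≡ sum (map (λ u → count (p ∘ (u ∷_)) (words U m)) U)
count-words-suc U m p =
  trans (count-concatMap p (λ v → map (v ∷_) (words U m)) U)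
        (cong sum (map-cong (λ u → count-map p (u ∷_) (words U m)) U))

All-words : {Q : ℕ → Set} {P : List ℕ → Set} (U : List ℕ) → All Q U → (m : ℕ) →
            (∀ w → length w ≡ m → All Q w → P w) → All P (words U m)
All-words U qU zero    H = H [] refl [] ∷ []
All-words {Q} {P} U qU (suc m) H = go U qU
  where
  go : (V : List ℕ) → All Q V → All P (concatMap (λ v → map (v ∷_) (words U m)) V)
  go []      []        = []
  go (v ∷ V) (qv ∷ qV) = ++⁺ (map⁺ (All-words U qU m (λ w l a → H (v ∷ w) (cong suc l) (qv ∷ a)))) (go V qV)

length-words : (U : List ℕ) (m : ℕ) → All (λ w → length w ≡ m) (words U m)
length-words U m = All-words {Q = λ _ → ⊤} U (All.universal _ U) m (λ w l _ → l)

count-words-map : (g : ℕ → ℕ) (V : List ℕ) (m : ℕ) (p : List ℕ → Bool) →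
                  count p (words (map g V) m) ≡ count (p ∘ map g) (words V m)
count-words-map g V zero    p = refl
count-words-map g V (suc m) p = begin
  count p (words (map g V) (suc m))
    ≡⟨ count-words-suc (map g V) m p ⟩
  sum (map (λ u → count (p ∘ (u ∷_)) (words (map g V) m)) (map g V))
    ≡⟨ sum-map-∘ _ g V ⟩
  sum (map (λ v → count (p ∘ (g v ∷_)) (words (map g V) m)) V)
    ≡⟨ cong sum (map-cong (λ v → count-words-map g V m (p ∘ (g v ∷_))) V) ⟩
  sum (map (λ v → count (λ w → p (g v ∷ map g w)) (words V m)) V)
    ≡⟨ count-words-suc V m (p ∘ map g) ⟨
  count (p ∘ map g) (words V (suc m)) ∎
  where open ≡-Reasoning

occ : ℕ → List ℕ → ℕ
occ c = count (c ≡ᵇ_)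

count-words-∷-absent : (c : ℕ) (U : List ℕ) (m : ℕ) (p : List ℕ → Bool) → (∀ w → 0 < occ c w → p w ≡ false) →
                       count p (words (c ∷ U) m) ≡ count p (words U m)
count-words-∷-absent c U zero    p h = refl
count-words-∷-absent c U (suc m) p h = begin
  count p (words (c ∷ U) (suc m))
    ≡⟨ count-words-suc (c ∷ U) m p ⟩
  count (p ∘ (c ∷_)) (words (c ∷ U) m) + sum (map (λ u → count (p ∘ (u ∷_)) (words (c ∷ U) m)) U)
    ≡⟨ cong₂ _+_ (count-false (p ∘ (c ∷_)) (words (c ∷ U) m) (λ w → h (c ∷ w) (hasC w)))
                 (cong sum (map-cong (λ u → count-words-∷-absent c U m (p ∘ (u ∷_)) (λ w o → h (u ∷ w) (keepsC u w o))) U)) ⟩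
  sum (map (λ u → count (p ∘ (u ∷_)) (words U m)) U)
    ≡⟨ count-words-suc U m p ⟨
  count p (words U (suc m)) ∎
  where
  open ≡-Reasoning
  hasC : ∀ w → 0 < occ c (c ∷ w)
  hasC w rewrite ≡ᵇ-refl c = s≤s z≤n
  keepsC : ∀ u w → 0 < occ c w → 0 < occ c (u ∷ w)
  keepsC u w o = <-≤-trans o (m≤n+m (occ c w) [ c ≡ᵇ u ]ᵇ)

insertAt : ℕ → ℕ → List ℕ → List ℕ
insertAt zero    c w       = c ∷ w
insertAt (suc x) c []      = c ∷ []
insertAt (suc x) c (y ∷ w) = y ∷ insertAt x c w

sum-select : (c : ℕ) (g : ℕ → ℕ) (U : List ℕ) → sum (map (λ u → if c ≡ᵇ u then g u else 0) U) ≡ occ c U * g c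
sum-select c g []      = refl
sum-select c g (u ∷ U) with c ≡ᵇ u in eq
... | true rewrite sym (≡ᵇ-true⇒≡ c u eq) = cong (g c +_) (sum-select c g U)
... | false = sum-select c g U

count-words-at : (U : List ℕ) (c : ℕ) → occ c U ≡ 1 → ∀ x m (p : List ℕ → Bool) → x ≤ m →
                 count (λ w → (c ≡ᵇ nth w x) ∧ p w) (words U (suc m)) ≡ count (p ∘ insertAt x c) (words U m)
count-words-at U c once zero m p _ = begin
  count (λ w → (c ≡ᵇ nth w 0) ∧ p w) (words U (suc m))
    ≡⟨ count-words-suc U m (λ w → (c ≡ᵇ nth w 0) ∧ p w) ⟩
  sum (map (λ u → count (λ w → (c ≡ᵇ u) ∧ p (u ∷ w)) (words U m)) U)
    ≡⟨ cong sum (map-cong (λ u → count-∧ˡ (c ≡ᵇ u) (p ∘ (u ∷_)) (words U m)) U) ⟩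
  sum (map (λ u → if c ≡ᵇ u then count (p ∘ (u ∷_)) (words U m) else 0) U)
    ≡⟨ sum-select c (λ u → count (p ∘ (u ∷_)) (words U m)) U ⟩
  occ c U * count (p ∘ (c ∷_)) (words U m)
    ≡⟨ cong (_* count (p ∘ (c ∷_)) (words U m)) once ⟩
  1 * count (p ∘ (c ∷_)) (words U m)
    ≡⟨ *-identityˡ _ ⟩
  count (p ∘ (c ∷_)) (words U m) ∎
  where open ≡-Reasoning
count-words-at U c once (suc x) (suc m) p (s≤s x≤m) = begin
  count (λ w → (c ≡ᵇ nth w (suc x)) ∧ p w) (words U (suc (suc m)))
    ≡⟨ count-words-suc U (suc m) (λ w → (c ≡ᵇ nth w (suc x)) ∧ p w) ⟩
  sum (map (λ u → count (λ w → (c ≡ᵇ nth w x) ∧ p (u ∷ w)) (words U (suc m))) U)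
    ≡⟨ cong sum (map-cong (λ u → count-words-at U c once x m (p ∘ (u ∷_)) x≤m) U) ⟩
  sum (map (λ u → count (λ w → p (u ∷ insertAt x c w)) (words U m)) U)
    ≡⟨ count-words-suc U m (p ∘ insertAt (suc x) c) ⟨
  count (p ∘ insertAt (suc x) c) (words U (suc m)) ∎
  where open ≡-Reasoning

count-by-position : (P : List ℕ → Bool) (q : ℕ → List ℕ → Bool) (xs : List ℕ) (ws : List (List ℕ)) →
                    All (λ w → P w ≡ true → sum (map (λ x → [ q x w ]ᵇ) xs) ≡ 1) ws →
                    count P ws ≡ sum (map (λ x → count (λ w → q x w ∧ P w) ws) xs)
count-by-position P q xs []       []       = sym (sum-map-0 xs)
count-by-position P q xs (w ∷ ws) (h ∷ hs) =
  trans (cong₂ _+_ head (count-by-position P q xs ws hs))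
        (sym (sum-map-+ (λ x → [ q x w ∧ P w ]ᵇ) (λ x → count (λ w → q x w ∧ P w) ws) xs))
  where
  head : [ P w ]ᵇ ≡ sum (map (λ x → [ q x w ∧ P w ]ᵇ) xs)
  head with P w
  ... | true  = trans (sym (h refl)) (cong sum (map-cong (λ x → cong [_]ᵇ (sym (∧-identityʳ (q x w)))) xs))
  ... | false = trans (sym (sum-map-0 xs)) (cong sum (map-cong (λ x → cong [_]ᵇ (sym (∧-zeroʳ (q x w)))) xs))

BoolRel : Set
BoolRel = ℕ → ℕ → Bool

picks : List ℕ → List (ℕ × List ℕ)
picks []       = []
picks (x ∷ xs) = (x , xs) ∷ map (λ p → proj₁ p , x ∷ proj₂ p) (picks xs)

isMinimal : BoolRel → ℕ → List ℕ → Bool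
isMinimal ρ x rest = not (ρ x x ∨ any (λ y → ρ y x) rest)

-- Choose the element labelled 1 among the minimal ones and recurse; the fuel n is the length of X.
linExtN : ℕ → BoolRel → List ℕ → ℕ
linExtN zero    ρ X = 1
linExtN (suc n) ρ X =
  sum (map (λ p → if isMinimal ρ (proj₁ p) (proj₂ p) then linExtN n ρ (proj₂ p) else 0) (picks X))

linExt : BoolRel → List ℕ → ℕ
linExt ρ X = linExtN (length X) ρ X

picks-map : (f : ℕ → ℕ) (X : List ℕ) → picks (map f X) ≡ map (λ p → f (proj₁ p) , map f (proj₂ p)) (picks X)
picks-map f []       = refl
picks-map f (x ∷ xs) = cong ((f x , map f xs) ∷_) (begin
  map (λ p → proj₁ p , f x ∷ proj₂ p) (picks (map f xs))
    ≡⟨ cong (map _) (picks-map f xs) ⟩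
  map (λ p → proj₁ p , f x ∷ proj₂ p) (map (λ p → f (proj₁ p) , map f (proj₂ p)) (picks xs))
    ≡⟨ map-∘ (picks xs) ⟨
  map (λ p → f (proj₁ p) , f x ∷ map f (proj₂ p)) (picks xs)
    ≡⟨ map-∘ (picks xs) ⟩
  map (λ p → f (proj₁ p) , map f (proj₂ p)) (map (λ p → proj₁ p , x ∷ proj₂ p) (picks xs)) ∎)
  where open ≡-Reasoning

isMinimal-map : (ρ : BoolRel) (f : ℕ → ℕ) (x : ℕ) (r : List ℕ) → isMinimal ρ (f x) (map f r) ≡ isMinimal (ρ on f) x r
isMinimal-map ρ f x r = cong (λ z → not (ρ (f x) (f x) ∨ z)) (any-map (λ y → ρ y (f x)) f r)

linExtN-map : (n : ℕ) (ρ : BoolRel) (f : ℕ → ℕ) (X : List ℕ) → linExtN n ρ (map f X) ≡ linExtN n (ρ on f) X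
linExtN-map zero    ρ f X = refl
linExtN-map (suc n) ρ f X = begin
  sum (map G (picks (map f X)))
    ≡⟨ cong (sum ∘ map G) (picks-map f X) ⟩
  sum (map G (map (λ p → f (proj₁ p) , map f (proj₂ p)) (picks X)))
    ≡⟨ sum-map-∘ G _ (picks X) ⟩
  sum (map (λ p → G (f (proj₁ p) , map f (proj₂ p))) (picks X))
    ≡⟨ cong sum (map-cong (λ p → cong₂ (λ b e → if b then e else 0) (isMinimal-map ρ f (proj₁ p) (proj₂ p))
                                                                    (linExtN-map n ρ f (proj₂ p))) (picks X)) ⟩
  sum (map (λ p → if isMinimal (ρ on f) (proj₁ p) (proj₂ p) then linExtN n (ρ on f) (proj₂ p) else 0) (picks X)) ∎
  where
  open ≡-Reasoning
  G : ℕ × List ℕ → ℕ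
  G p = if isMinimal ρ (proj₁ p) (proj₂ p) then linExtN n ρ (proj₂ p) else 0

linExt-map : (ρ : BoolRel) (f : ℕ → ℕ) (X : List ℕ) → linExt ρ (map f X) ≡ linExt (ρ on f) X
linExt-map ρ f X rewrite length-map f X = linExtN-map (length X) ρ f X

upToWithout : ℕ → ℕ → List ℕ
upToWithout x N = upTo x ++ map (suc x +_) (upTo (N ∸ x))

picks-upTo : ∀ N → picks (upTo (suc N)) ≡ map (λ x → x , upToWithout x N) (upTo (suc N))
picks-upTo zero    = refl
picks-upTo (suc N) = begin
  picks (upTo (suc (suc N)))
    ≡⟨ cong picks (upTo-suc (suc N)) ⟩
  (0 , map suc (upTo (suc N))) ∷ map F0 (picks (map suc (upTo (suc N))))
    ≡⟨ cong (λ l → (0 , map suc (upTo (suc N))) ∷ map F0 l) (picks-map suc (upTo (suc N))) ⟩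
  (0 , map suc (upTo (suc N))) ∷ map F0 (map Fsuc (picks (upTo (suc N))))
    ≡⟨ cong (λ l → (0 , map suc (upTo (suc N))) ∷ map F0 (map Fsuc l)) (picks-upTo N) ⟩
  (0 , map suc (upTo (suc N))) ∷ map F0 (map Fsuc (map (λ x → x , upToWithout x N) (upTo (suc N))))
    ≡⟨ cong ((0 , map suc (upTo (suc N))) ∷_) (trans (sym (map-∘ _)) (sym (map-∘ _))) ⟩
  (0 , map suc (upTo (suc N))) ∷ map (λ x → suc x , 0 ∷ map suc (upToWithout x N)) (upTo (suc N))
    ≡⟨ cong ((0 , map suc (upTo (suc N))) ∷_)
            (trans (map-cong (λ x → cong (suc x ,_) (suc-upToWithout x)) (upTo (suc N))) (map-∘ (upTo (suc N)))) ⟩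
  (0 , upToWithout 0 (suc N)) ∷ map (λ x → x , upToWithout x (suc N)) (map suc (upTo (suc N)))
    ≡⟨ cong (map (λ x → x , upToWithout x (suc N))) (upTo-suc (suc N)) ⟨
  map (λ x → x , upToWithout x (suc N)) (upTo (suc (suc N))) ∎
  where
  open ≡-Reasoning
  F0 Fsuc : ℕ × List ℕ → ℕ × List ℕ
  F0 p   = proj₁ p , 0 ∷ proj₂ p
  Fsuc p = suc (proj₁ p) , map suc (proj₂ p)
  suc-upToWithout : ∀ x → 0 ∷ map suc (upToWithout x N) ≡ upToWithout (suc x) (suc N)
  suc-upToWithout x = cong (0 ∷_) (trans (map-++ suc (upTo x) _) (cong₂ _++_ (map-upTo suc x) (sym (map-∘ (upTo (N ∸ x))))))

punchIn : ℕ → ℕ → ℕ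
punchIn x a = if a <ᵇ x then a else suc a

punchIn-< : ∀ {x a} → a < x → punchIn x a ≡ a
punchIn-< {x} {a} a<x = cong (λ b → if b then a else suc a) (<⇒<ᵇ-true a<x)

punchIn-≥ : ∀ {x a} → x ≤ a → punchIn x a ≡ suc a
punchIn-≥ {x} {a} x≤a = cong (λ b → if b then a else suc a) (≥⇒<ᵇ-false x≤a)

punchIn-suc : ∀ x a → punchIn (suc x) (suc a) ≡ suc (punchIn x a)
punchIn-suc x a with a <ᵇ x
... | true  = refl
... | false = refl

punchIn<suc : ∀ x N a → a < N → punchIn x a < suc N
punchIn<suc x N a a<N with a <ᵇ x
... | true  = ≤-trans a<N (n≤1+n N)
... | false = s≤s a<N

upTo-+ : ∀ x k → upTo (x + k) ≡ upTo x ++ map (x +_) (upTo k)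
upTo-+ zero    k = sym (map-id (upTo k))
upTo-+ (suc x) k = begin
  upTo (suc (x + k))                                      ≡⟨ upTo-suc (x + k) ⟩
  0 ∷ map suc (upTo (x + k))                              ≡⟨ cong (λ l → 0 ∷ map suc l) (upTo-+ x k) ⟩
  0 ∷ map suc (upTo x ++ map (x +_) (upTo k))             ≡⟨ cong (0 ∷_) (map-++ suc (upTo x) _) ⟩
  0 ∷ (map suc (upTo x) ++ map suc (map (x +_) (upTo k))) ≡⟨ cong (λ l → 0 ∷ (map suc (upTo x) ++ l)) (map-∘ (upTo k)) ⟨
  (0 ∷ map suc (upTo x)) ++ map (suc x +_) (upTo k)       ≡⟨ cong (_++ map (suc x +_) (upTo k)) (upTo-suc x) ⟨
  upTo (suc x) ++ map (suc x +_) (upTo k)                 ∎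
  where open ≡-Reasoning

map-punchIn-upTo : ∀ x N → x ≤ N → map (punchIn x) (upTo N) ≡ upToWithout x N
map-punchIn-upTo x N x≤N = begin
  map (punchIn x) (upTo N)
    ≡⟨ cong (map (punchIn x)) (trans (cong upTo (sym (m+[n∸m]≡n x≤N))) (upTo-+ x (N ∸ x))) ⟩
  map (punchIn x) (upTo x ++ map (x +_) (upTo (N ∸ x)))
    ≡⟨ map-++ (punchIn x) (upTo x) _ ⟩
  map (punchIn x) (upTo x) ++ map (punchIn x) (map (x +_) (upTo (N ∸ x)))
    ≡⟨ cong₂ _++_ (map-id-local (All.map punchIn-< (all-upTo x)))
                  (trans (sym (map-∘ (upTo (N ∸ x)))) (map-cong (λ b → punchIn-≥ (m≤m+n x b)) (upTo (N ∸ x)))) ⟩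
  upToWithout x N ∎
  where open ≡-Reasoning

punchIn-cover : ∀ x N a → x ≤ N → a < suc N → a ≡ x ⊎ Σ ℕ (λ a′ → a′ < N × punchIn x a′ ≡ a)
punchIn-cover x N a x≤N a<sN with <-cmp a x
... | tri< a<x _ _ = inj₂ (a , <-≤-trans a<x x≤N , punchIn-< a<x)
... | tri≈ _ a≡x _ = inj₁ a≡x
punchIn-cover x N (suc a) x≤N (s≤s a<N) | tri> _ _ x<sa = inj₂ (a , a<N , punchIn-≥ (≤-pred x<sa))

bijectiveᵇ : ℕ → List ℕ → Bool
bijectiveᵇ N L = all (λ v → occ v L ≡ᵇ 1) (labels N)

preservesᵇ : ℕ → BoolRel → List ℕ → Bool
preservesᵇ N ρ L = all (λ a → all (λ b → not (ρ a b) ∨ (nth L a <ᵇ nth L b)) (upTo N)) (upTo N)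

countLinExt : ℕ → BoolRel → ℕ
countLinExt N ρ = count (λ L → bijectiveᵇ N L ∧ preservesᵇ N ρ L) (words (labels N) N)

OrderPreserving : ℕ → BoolRel → List ℕ → Set
OrderPreserving N ρ L = ∀ a b → a < N → b < N → ρ a b ≡ true → nth L a < nth L b

preservesᵇ-sound : ∀ N ρ L → preservesᵇ N ρ L ≡ true → OrderPreserving N ρ L
preservesᵇ-sound N ρ L h a b a<N b<N r =
  <ᵇ-true⇒< _ _ (subst (λ z → (not z ∨ (nth L a <ᵇ nth L b)) ≡ true) r
                       (all-upTo⁻ _ N (all-upTo⁻ _ N h a a<N) b b<N))

preservesᵇ-complete : ∀ N ρ L → OrderPreserving N ρ L → preservesᵇ N ρ L ≡ true
preservesᵇ-complete N ρ L P = all-upTo⁺ _ N (λ a a<N → all-upTo⁺ _ N (λ b b<N → pair a b a<N b<N))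
  where
  pair : ∀ a b → a < N → b < N → (not (ρ a b) ∨ (nth L a <ᵇ nth L b)) ≡ true
  pair a b a<N b<N with ρ a b in e
  ... | true  = <⇒<ᵇ-true (P a b a<N b<N e)
  ... | false = refl

labels-suc : ∀ N → labels (suc N) ≡ 1 ∷ map suc (labels N)
labels-suc N = cong (map suc) (upTo-suc N)

occ-insertAt : ∀ c x d w → occ c (insertAt x d w) ≡ [ c ≡ᵇ d ]ᵇ + occ c w
occ-insertAt c zero    d w       = refl
occ-insertAt c (suc x) d []      = refl
occ-insertAt c (suc x) d (y ∷ w) = begin
  [ c ≡ᵇ y ]ᵇ + occ c (insertAt x d w)   ≡⟨ cong ([ c ≡ᵇ y ]ᵇ +_) (occ-insertAt c x d w) ⟩
  [ c ≡ᵇ y ]ᵇ + ([ c ≡ᵇ d ]ᵇ + occ c w)  ≡⟨ +-assoc [ c ≡ᵇ y ]ᵇ _ _ ⟨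
  [ c ≡ᵇ y ]ᵇ + [ c ≡ᵇ d ]ᵇ + occ c w    ≡⟨ cong (_+ occ c w) (+-comm [ c ≡ᵇ y ]ᵇ _) ⟩
  [ c ≡ᵇ d ]ᵇ + [ c ≡ᵇ y ]ᵇ + occ c w    ≡⟨ +-assoc [ c ≡ᵇ d ]ᵇ _ _ ⟩
  [ c ≡ᵇ d ]ᵇ + ([ c ≡ᵇ y ]ᵇ + occ c w)  ∎
  where open ≡-Reasoning

occ-map-suc : ∀ v w → occ (suc v) (map suc w) ≡ occ v w
occ-map-suc v w = count-map (suc v ≡ᵇ_) suc w

occ-0 : ∀ w → All (0 <_) w → occ 0 w ≡ 0
occ-0 []          []       = refl
occ-0 (suc y ∷ w) (_ ∷ ps) = occ-0 w ps

occ-1-labels : ∀ N → occ 1 (labels (suc N)) ≡ 1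
occ-1-labels N = trans (cong (occ 1) (labels-suc N))
  (cong suc (trans (occ-map-suc 0 (labels N)) (trans (count-map (0 ≡ᵇ_) suc (upTo N)) (count-false _ (upTo N) (λ _ → refl)))))

All-pos-map-suc : ∀ xs → All (0 <_) (map suc xs)
All-pos-map-suc xs = map⁺ (All.universal (λ _ → s≤s z≤n) xs)

bijectiveᵇ-suc : ∀ N L → bijectiveᵇ (suc N) L ≡ (occ 1 L ≡ᵇ 1) ∧ all (λ v → occ (suc v) L ≡ᵇ 1) (labels N)
bijectiveᵇ-suc N L = trans (cong (all (λ v → occ v L ≡ᵇ 1)) (labels-suc N)) (cong ((occ 1 L ≡ᵇ 1) ∧_) (all-map _ suc (labels N)))

bijectiveᵇ-insert1 : ∀ N x w → All (0 <_) w → bijectiveᵇ (suc N) (insertAt x 1 (map suc w)) ≡ bijectiveᵇ N w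
bijectiveᵇ-insert1 N x w pos = begin
  bijectiveᵇ (suc N) W
    ≡⟨ bijectiveᵇ-suc N W ⟩
  (occ 1 W ≡ᵇ 1) ∧ all (λ v → occ (suc v) W ≡ᵇ 1) (labels N)
    ≡⟨ cong (λ k → (k ≡ᵇ 1) ∧ all (λ v → occ (suc v) W ≡ᵇ 1) (labels N))
            (trans (occ-insertAt 1 x 1 (map suc w)) (cong suc (trans (occ-map-suc 0 w) (occ-0 w pos)))) ⟩
  all (λ v → occ (suc v) W ≡ᵇ 1) (labels N)
    ≡⟨ all-map _ suc (upTo N) ⟩
  all (λ i → occ (suc (suc i)) W ≡ᵇ 1) (upTo N)
    ≡⟨ all-cong (upTo N) (λ i → cong (_≡ᵇ 1) (trans (occ-insertAt (suc (suc i)) x 1 (map suc w)) (occ-map-suc (suc i) w))) ⟩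
  all (λ i → occ (suc i) w ≡ᵇ 1) (upTo N)
    ≡⟨ all-map _ suc (upTo N) ⟨
  bijectiveᵇ N w ∎
  where
  open ≡-Reasoning
  W = insertAt x 1 (map suc w)

nth-insertAt : ∀ x c w → x ≤ length w → nth (insertAt x c w) x ≡ c
nth-insertAt zero    c w       _         = refl
nth-insertAt (suc x) c (y ∷ w) (s≤s x≤) = nth-insertAt x c w x≤

nth-insertAt-punchIn : ∀ x c w → x ≤ length w → ∀ a → nth (insertAt x c w) (punchIn x a) ≡ nth w a
nth-insertAt-punchIn zero    c w       _         a       = refl
nth-insertAt-punchIn (suc x) c (y ∷ w) _         zero    = refl
nth-insertAt-punchIn (suc x) c (y ∷ w) (s≤s x≤) (suc a) rewrite punchIn-suc x a = nth-insertAt-punchIn x c w x≤ a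

nth-map-suc : ∀ w a → a < length w → nth (map suc w) a ≡ suc (nth w a)
nth-map-suc (y ∷ w) zero    _         = refl
nth-map-suc (y ∷ w) (suc a) (s≤s a<) = nth-map-suc w a a<

nth-All : {P : ℕ → Set} → ∀ w a → All P w → a < length w → P (nth w a)
nth-All (y ∷ w) zero    (p ∷ _)  _         = p
nth-All (y ∷ w) (suc a) (_ ∷ ps) (s≤s a<) = nth-All w a ps a<

module InsertLabel1 (N x : ℕ) (ρ : BoolRel) (w : List ℕ) (x≤N : x ≤ N) (lw : length w ≡ N) (pos : All (0 <_) w) where

  W : List ℕ
  W = insertAt x 1 (map suc w)

  x≤len : x ≤ length (map suc w)
  x≤len = subst (x ≤_) (sym (trans (length-map suc w) lw)) x≤N

  W-at-x : nth W x ≡ 1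
  W-at-x = nth-insertAt x 1 (map suc w) x≤len

  W-at-punchIn : ∀ a → a < N → nth W (punchIn x a) ≡ suc (nth w a)
  W-at-punchIn a a<N = trans (nth-insertAt-punchIn x 1 (map suc w) x≤len a) (nth-map-suc w a (subst (a <_) (sym lw) a<N))

  w-pos : ∀ a → a < N → 0 < nth w a
  w-pos a a<N = nth-All w a pos (subst (a <_) (sym lw) a<N)

  minimal : Bool
  minimal = isMinimal ρ x (map (punchIn x) (upTo N))

  ⇒minimal : OrderPreserving (suc N) ρ W → minimal ≡ true
  ⇒minimal P = cong₂ (λ a b → not (a ∨ b)) irreflexive
                      (trans (any-map (λ y → ρ y x) (punchIn x) (upTo N)) (any-upTo-false⁺ _ N below))
    where
    irreflexive : ρ x x ≡ false
    irreflexive with ρ x x in e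
    ... | true  = ⊥-elim (<-irrefl refl (P x x (s≤s x≤N) (s≤s x≤N) e))
    ... | false = refl
    below : ∀ a → a < N → ρ (punchIn x a) x ≡ false
    below a a<N with ρ (punchIn x a) x in e
    ... | true  with subst₂ _<_ (W-at-punchIn a a<N) W-at-x (P _ x (punchIn<suc x N a a<N) (s≤s x≤N) e)
    ...   | s≤s ()
    below a a<N | false = refl

  ⇒preserves : OrderPreserving (suc N) ρ W → OrderPreserving N (ρ on punchIn x) w
  ⇒preserves P a b a<N b<N r =
    ≤-pred (subst₂ _<_ (W-at-punchIn a a<N) (W-at-punchIn b b<N) (P _ _ (punchIn<suc x N a a<N) (punchIn<suc x N b b<N) r))

  minimal⇒irreflexive : minimal ≡ true → ρ x x ≡ false
  minimal⇒irreflexive m = proj₁ (∨-≡false⁻ (not-≡true⁻ m))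

  minimal⇒below : minimal ≡ true → ∀ a → a < N → ρ (punchIn x a) x ≡ false
  minimal⇒below m = any-upTo-false⁻ _ N
    (trans (sym (any-map (λ y → ρ y x) (punchIn x) (upTo N))) (proj₂ (∨-≡false⁻ {ρ x x} (not-≡true⁻ m))))

  ⇐ : minimal ≡ true → OrderPreserving N (ρ on punchIn x) w → OrderPreserving (suc N) ρ W
  ⇐ m P a b a<sN b<sN r with punchIn-cover x N a x≤N a<sN | punchIn-cover x N b x≤N b<sN
  ... | inj₁ refl | inj₁ refl = true≢false r (minimal⇒irreflexive m)
  ... | inj₁ refl | inj₂ (b′ , b′<N , refl) = subst₂ _<_ (sym W-at-x) (sym (W-at-punchIn b′ b′<N)) (s≤s (w-pos b′ b′<N))
  ... | inj₂ (a′ , a′<N , refl) | inj₁ refl = true≢false r (minimal⇒below m a′ a′<N)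
  ... | inj₂ (a′ , a′<N , refl) | inj₂ (b′ , b′<N , refl) =
    subst₂ _<_ (sym (W-at-punchIn a′ a′<N)) (sym (W-at-punchIn b′ b′<N)) (s≤s (P a′ b′ a′<N b′<N r))

  preservesᵇ-insert1 : preservesᵇ (suc N) ρ W ≡ minimal ∧ preservesᵇ N (ρ on punchIn x) w
  preservesᵇ-insert1 = bool-ext
    (λ h → let P = preservesᵇ-sound (suc N) ρ W h in cong₂ _∧_ (⇒minimal P) (preservesᵇ-complete N _ w (⇒preserves P)))
    (λ h → let m , p = ∧-≡true⁻ {minimal} h in preservesᵇ-complete (suc N) ρ W (⇐ m (preservesᵇ-sound N _ w p)))

occ-via-nth : ∀ c w → sum (map (λ x → [ c ≡ᵇ nth w x ]ᵇ) (upTo (length w))) ≡ occ c w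
occ-via-nth c []      = refl
occ-via-nth c (y ∷ w) =
  trans (sum-upTo-suc (λ x → [ c ≡ᵇ nth (y ∷ w) x ]ᵇ) (length w)) (cong ([ c ≡ᵇ y ]ᵇ +_) (occ-via-nth c w))

count-label1-at : ∀ N ρ x → x ≤ N →
  count (λ w → (1 ≡ᵇ nth w x) ∧ (bijectiveᵇ (suc N) w ∧ preservesᵇ (suc N) ρ w)) (words (labels (suc N)) (suc N)) ≡
  (if isMinimal ρ x (map (punchIn x) (upTo N)) then countLinExt N (ρ on punchIn x) else 0)
count-label1-at N ρ x x≤N = begin
  count (λ w → (1 ≡ᵇ nth w x) ∧ P w) (words U (suc N))
    ≡⟨ count-words-at U 1 (occ-1-labels N) x N P x≤N ⟩
  count (P ∘ insertAt x 1) (words U N)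
    ≡⟨ cong (λ V → count (P ∘ insertAt x 1) (words V N)) (labels-suc N) ⟩
  count (P ∘ insertAt x 1) (words (1 ∷ map suc (labels N)) N)
    ≡⟨ count-words-∷-absent 1 (map suc (labels N)) N _ twice ⟩
  count (P ∘ insertAt x 1) (words (map suc (labels N)) N)
    ≡⟨ count-words-map suc (labels N) N _ ⟩
  count (λ w → P (insertAt x 1 (map suc w))) (words (labels N) N)
    ≡⟨ count-cong _ (All-words {Q = 0 <_} (labels N) (All-pos-map-suc (upTo N)) N shifted) ⟩
  count (λ w → m ∧ (bijectiveᵇ N w ∧ preservesᵇ N (ρ on punchIn x) w)) (words (labels N) N)
    ≡⟨ count-∧ˡ m (λ w → bijectiveᵇ N w ∧ preservesᵇ N (ρ on punchIn x) w) (words (labels N) N) ⟩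
  (if m then countLinExt N (ρ on punchIn x) else 0) ∎
  where
  open ≡-Reasoning
  U = labels (suc N)
  P : List ℕ → Bool
  P L = bijectiveᵇ (suc N) L ∧ preservesᵇ (suc N) ρ L
  m = isMinimal ρ x (map (punchIn x) (upTo N))
  twice : ∀ w → 0 < occ 1 w → P (insertAt x 1 w) ≡ false
  twice w o rewrite bijectiveᵇ-suc N (insertAt x 1 w) | occ-insertAt 1 x 1 w with occ 1 w | o
  ... | suc k | _ = refl
  shifted : ∀ w → length w ≡ N → All (0 <_) w →
            P (insertAt x 1 (map suc w)) ≡ m ∧ (bijectiveᵇ N w ∧ preservesᵇ N (ρ on punchIn x) w)
  shifted w lw pos rewrite bijectiveᵇ-insert1 N x w pos | InsertLabel1.preservesᵇ-insert1 N x ρ w x≤N lw pos =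
    ∧-swap (bijectiveᵇ N w) m _
    where
    ∧-swap : ∀ a b c → a ∧ (b ∧ c) ≡ b ∧ (a ∧ c)
    ∧-swap true  b     c = refl
    ∧-swap false true  c = refl
    ∧-swap false false c = refl

-- Classify the labelings by the position x of the label 1.
countLinExt-suc : ∀ N ρ → countLinExt (suc N) ρ ≡
  sum (map (λ x → if isMinimal ρ x (map (punchIn x) (upTo N)) then countLinExt N (ρ on punchIn x) else 0) (upTo (suc N)))
countLinExt-suc N ρ = begin
  count P (words U (suc N))
    ≡⟨ count-by-position P (λ x w → 1 ≡ᵇ nth w x) (upTo (suc N)) (words U (suc N))
                         (All.map (λ {w} → label1-once {w}) (length-words U (suc N))) ⟩
  sum (map (λ x → count (λ w → (1 ≡ᵇ nth w x) ∧ P w) (words U (suc N))) (upTo (suc N)))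
    ≡⟨ cong sum (map-cong-local (All.map (λ x<sN → count-label1-at N ρ _ (≤-pred x<sN)) (all-upTo (suc N)))) ⟩
  sum (map (λ x → if isMinimal ρ x (map (punchIn x) (upTo N)) then countLinExt N (ρ on punchIn x) else 0) (upTo (suc N))) ∎
  where
  open ≡-Reasoning
  U = labels (suc N)
  P : List ℕ → Bool
  P L = bijectiveᵇ (suc N) L ∧ preservesᵇ (suc N) ρ L
  label1-once : ∀ {w} → length w ≡ suc N → P w ≡ true → sum (map (λ x → [ 1 ≡ᵇ nth w x ]ᵇ) (upTo (suc N))) ≡ 1
  label1-once {w} lw Pw = begin
    sum (map (λ x → [ 1 ≡ᵇ nth w x ]ᵇ) (upTo (suc N)))
      ≡⟨ cong (λ n → sum (map (λ x → [ 1 ≡ᵇ nth w x ]ᵇ) (upTo n))) lw ⟨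
    sum (map (λ x → [ 1 ≡ᵇ nth w x ]ᵇ) (upTo (length w)))
      ≡⟨ occ-via-nth 1 w ⟩
    occ 1 w
      ≡⟨ ≡ᵇ-true⇒≡ _ _ (proj₁ (∧-≡true⁻ (trans (sym (bijectiveᵇ-suc N w)) (proj₁ (∧-≡true⁻ Pw))))) ⟩
    1 ∎

linExt-upTo-suc : ∀ N ρ → linExt ρ (upTo (suc N)) ≡
  sum (map (λ x → if isMinimal ρ x (upToWithout x N) then linExtN N ρ (upToWithout x N) else 0) (upTo (suc N)))
linExt-upTo-suc N ρ = begin
  linExtN (length (upTo (suc N))) ρ (upTo (suc N))
    ≡⟨ cong (λ n → linExtN n ρ (upTo (suc N))) (length-upTo (suc N)) ⟩
  sum (map G (picks (upTo (suc N))))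
    ≡⟨ cong (sum ∘ map G) (picks-upTo N) ⟩
  sum (map G (map (λ x → x , upToWithout x N) (upTo (suc N))))
    ≡⟨ sum-map-∘ G _ (upTo (suc N)) ⟩
  sum (map (λ x → if isMinimal ρ x (upToWithout x N) then linExtN N ρ (upToWithout x N) else 0) (upTo (suc N))) ∎
  where
  open ≡-Reasoning
  G : ℕ × List ℕ → ℕ
  G p = if isMinimal ρ (proj₁ p) (proj₂ p) then linExtN N ρ (proj₂ p) else 0

linExt-upTo-suc-punchIn : ∀ N ρ → linExt ρ (upTo (suc N)) ≡
  sum (map (λ x → if isMinimal ρ x (map (punchIn x) (upTo N)) then linExt (ρ on punchIn x) (upTo N) else 0) (upTo (suc N)))
linExt-upTo-suc-punchIn N ρ =
  trans (linExt-upTo-suc N ρ) (cong sum (map-cong-local (All.map (λ x<sN → pick _ (≤-pred x<sN)) (all-upTo (suc N)))))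
  where
  pick : ∀ x → x ≤ N → (if isMinimal ρ x (upToWithout x N) then linExtN N ρ (upToWithout x N) else 0) ≡
                       (if isMinimal ρ x (map (punchIn x) (upTo N)) then linExt (ρ on punchIn x) (upTo N) else 0)
  pick x x≤N rewrite sym (map-punchIn-upTo x N x≤N) =
    cong (λ e → if isMinimal ρ x (map (punchIn x) (upTo N)) then e else 0)
         (trans (linExtN-map N ρ (punchIn x) (upTo N)) (cong (λ n → linExtN n (ρ on punchIn x) (upTo N)) (sym (length-upTo N))))

countLinExt≡linExt : ∀ N ρ → countLinExt N ρ ≡ linExt ρ (upTo N)
countLinExt≡linExt zero    ρ = refl
countLinExt≡linExt (suc N) ρ =
  trans (countLinExt-suc N ρ)
        (trans (cong sum (map-cong (λ x → cong (λ e → if isMinimal ρ x (map (punchIn x) (upTo N)) then e else 0)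
                                                 (countLinExt≡linExt N (ρ on punchIn x))) (upTo (suc N))))
               (sym (linExt-upTo-suc-punchIn N ρ)))

All-picks : {P : ℕ → Set} (X : List ℕ) → All P X →
            All (λ p → P (proj₁ p) × All P (proj₂ p) × suc (length (proj₂ p)) ≡ length X) (picks X)
All-picks []       []         = []
All-picks (x ∷ xs) (px ∷ pxs) =
  (px , pxs , refl) ∷ map⁺ (All.map (λ { (a , b , c) → a , px ∷ b , cong suc c }) (All-picks xs pxs))

linExtN-cong : (P : ℕ → Set) → ∀ n ρ ρ′ X → All P X → (∀ a b → P a → P b → ρ a b ≡ ρ′ a b) →
               linExtN n ρ X ≡ linExtN n ρ′ X
linExtN-cong P zero    ρ ρ′ X _  _ = refl
linExtN-cong P (suc n) ρ ρ′ X pX h = cong sum (map-cong-local (All.map step (All-picks X pX)))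
  where
  step : ∀ {p} → P (proj₁ p) × All P (proj₂ p) × suc (length (proj₂ p)) ≡ length X →
         (if isMinimal ρ (proj₁ p) (proj₂ p) then linExtN n ρ (proj₂ p) else 0) ≡
         (if isMinimal ρ′ (proj₁ p) (proj₂ p) then linExtN n ρ′ (proj₂ p) else 0)
  step {x , r} (px , pr , _) = cong₂ (λ b e → if b then e else 0)
    (cong₂ (λ a b → not (a ∨ b)) (h x x px px) (any-cong r (All.map (λ py → h _ x py px) pr)))
    (linExtN-cong P n ρ ρ′ r pr h)

linExt-cong : ∀ ρ ρ′ X → (∀ a b → ρ a b ≡ ρ′ a b) → linExt ρ X ≡ linExt ρ′ X
linExt-cong ρ ρ′ X h = linExtN-cong (λ _ → ⊤) (length X) ρ ρ′ X (All.universal _ X) (λ a b _ _ → h a b)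

any-↭ : (p : ℕ → Bool) {X Y : List ℕ} → X ↭ Y → any p X ≡ any p Y
any-↭ p ↭.refl          = refl
any-↭ p (↭.prep x q)    = cong (p x ∨_) (any-↭ p q)
any-↭ p (↭.swap x y q)  rewrite any-↭ p q = swap (p x) (p y) _
  where
  swap : ∀ a b c → a ∨ (b ∨ c) ≡ b ∨ (a ∨ c)
  swap true  true  c = refl
  swap true  false c = refl
  swap false b     c = refl
any-↭ p (↭.trans q q′) = trans (any-↭ p q) (any-↭ p q′)

sum-picks-↭ : {X Y : List ℕ} → X ↭ Y → (h : ℕ × List ℕ → ℕ) →
              (∀ x r r′ → r ↭ r′ → h (x , r) ≡ h (x , r′)) →
              sum (map h (picks X)) ≡ sum (map h (picks Y))
sum-picks-↭ ↭.refl h hr = refl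
sum-picks-↭ {x ∷ xs} {x ∷ ys} (↭.prep x q) h hr = cong₂ _+_ (hr x xs ys q)
  (trans (sum-map-∘ h _ (picks xs)) (trans (sum-picks-↭ q _ (λ z r r′ e → hr z _ _ (↭.prep x e))) (sym (sum-map-∘ h _ (picks ys)))))
sum-picks-↭ {x ∷ y ∷ xs} {y ∷ x ∷ ys} (↭.swap x y q) h hr = begin
  h (x , y ∷ xs) + (h (y , x ∷ xs) + sum (map h (map Fx (map Fy (picks xs)))))
    ≡⟨ cong₂ _+_ (hr x _ _ (↭.prep y q)) (cong₂ _+_ (hr y _ _ (↭.prep x q)) rest) ⟩
  h (x , y ∷ ys) + (h (y , x ∷ ys) + sum (map h (map Fy (map Fx (picks ys)))))
    ≡⟨ x∙yz≈y∙xz (h (x , y ∷ ys)) (h (y , x ∷ ys)) _ ⟩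
  h (y , x ∷ ys) + (h (x , y ∷ ys) + sum (map h (map Fy (map Fx (picks ys))))) ∎
  where
  open ≡-Reasoning
  Fx Fy : ℕ × List ℕ → ℕ × List ℕ
  Fx p = proj₁ p , x ∷ proj₂ p
  Fy p = proj₁ p , y ∷ proj₂ p
  rest : sum (map h (map Fx (map Fy (picks xs)))) ≡ sum (map h (map Fy (map Fx (picks ys))))
  rest = begin
    sum (map h (map Fx (map Fy (picks xs))))
      ≡⟨ cong sum (trans (map-∘ (picks xs)) (map-∘ (map Fy (picks xs)))) ⟨
    sum (map (λ p → h (proj₁ p , x ∷ y ∷ proj₂ p)) (picks xs))
      ≡⟨ sum-picks-↭ q _ (λ z r r′ e → hr z _ _ (↭.prep x (↭.prep y e))) ⟩
    sum (map (λ p → h (proj₁ p , x ∷ y ∷ proj₂ p)) (picks ys))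
      ≡⟨ cong sum (map-cong (λ p → hr (proj₁ p) _ _ (↭.swap x y ↭.refl)) (picks ys)) ⟩
    sum (map (λ p → h (proj₁ p , y ∷ x ∷ proj₂ p)) (picks ys))
      ≡⟨ cong sum (trans (map-∘ (picks ys)) (map-∘ (map Fx (picks ys)))) ⟩
    sum (map h (map Fy (map Fx (picks ys)))) ∎
sum-picks-↭ (↭.trans q q′) h hr = trans (sum-picks-↭ q h hr) (sum-picks-↭ q′ h hr)

linExtN-↭ : ∀ n ρ {X Y} → X ↭ Y → linExtN n ρ X ≡ linExtN n ρ Y
linExtN-↭ zero    ρ q = refl
linExtN-↭ (suc n) ρ q = sum-picks-↭ q _ (λ x r r′ e →
  cong₂ (λ b z → if b then z else 0) (cong (λ z → not (ρ x x ∨ z)) (any-↭ (λ y → ρ y x) e)) (linExtN-↭ n ρ e))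

linExt-↭ : ∀ ρ {X Y} → X ↭ Y → linExt ρ X ≡ linExt ρ Y
linExt-↭ ρ {X} {Y} q = trans (cong (λ n → linExtN n ρ X) (↭-length q)) (linExtN-↭ (length Y) ρ q)

picks-++ : (Y Z : List ℕ) → picks (Y ++ Z) ≡
           map (λ p → proj₁ p , proj₂ p ++ Z) (picks Y) ++ map (λ p → proj₁ p , Y ++ proj₂ p) (picks Z)
picks-++ []      Z = sym (map-id (picks Z))
picks-++ (y ∷ Y) Z = cong ((y , Y ++ Z) ∷_) (begin
  map Fy (picks (Y ++ Z))                               ≡⟨ cong (map Fy) (picks-++ Y Z) ⟩
  map Fy (map FZ (picks Y) ++ map FY (picks Z))         ≡⟨ map-++ Fy (map FZ (picks Y)) _ ⟩
  map Fy (map FZ (picks Y)) ++ map Fy (map FY (picks Z))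
    ≡⟨ cong₂ _++_ (trans (sym (map-∘ (picks Y))) (map-∘ (picks Y))) (sym (map-∘ (picks Z))) ⟩
  map FZ (map Fy (picks Y)) ++ map (λ p → proj₁ p , (y ∷ Y) ++ proj₂ p) (picks Z) ∎)
  where
  open ≡-Reasoning
  Fy FZ FY : ℕ × List ℕ → ℕ × List ℕ
  Fy p = proj₁ p , y ∷ proj₂ p
  FZ p = proj₁ p , proj₂ p ++ Z
  FY p = proj₁ p , Y ++ proj₂ p

Unrelated : BoolRel → (ℕ → Set) → (ℕ → Set) → Set
Unrelated ρ PY PZ = ∀ a b → PY a → PZ b → ρ a b ≡ false × ρ b a ≡ false

isMinimal-++ʳ : ∀ ρ x r Z → All (λ z → ρ z x ≡ false) Z → isMinimal ρ x (r ++ Z) ≡ isMinimal ρ x r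
isMinimal-++ʳ ρ x r Z h rewrite any-++ (λ w → ρ w x) r Z | any-false (λ w → ρ w x) Z h
  | ∨-identityʳ (any (λ w → ρ w x) r) = refl

isMinimal-++ˡ : ∀ ρ x Y r → All (λ y → ρ y x ≡ false) Y → isMinimal ρ x (Y ++ r) ≡ isMinimal ρ x r
isMinimal-++ˡ ρ x Y r h rewrite any-++ (λ w → ρ w x) Y r | any-false (λ w → ρ w x) Y h = refl

pascal : ∀ a b → (a + suc b) C a + (suc a + b) C suc a ≡ (suc a + suc b) C suc a
pascal a b = subst (λ k → k C a + suc (a + b) C suc a ≡ suc k C suc a) (sym (+-suc a b))
                   (nCk+nC[k+1]≡[n+1]C[k+1] (suc (a + b)) a)

sum-picks-++ : (G : ℕ × List ℕ → ℕ) (Y Z : List ℕ) → sum (map G (picks (Y ++ Z))) ≡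
  sum (map (λ p → G (proj₁ p , proj₂ p ++ Z)) (picks Y)) + sum (map (λ p → G (proj₁ p , Y ++ proj₂ p)) (picks Z))
sum-picks-++ G Y Z = begin
  sum (map G (picks (Y ++ Z)))
    ≡⟨ cong (sum ∘ map G) (picks-++ Y Z) ⟩
  sum (map G (map FZ (picks Y) ++ map FY (picks Z)))
    ≡⟨ trans (cong sum (map-++ G (map FZ (picks Y)) _)) (sum-++ (map G (map FZ (picks Y))) _) ⟩
  sum (map G (map FZ (picks Y))) + sum (map G (map FY (picks Z)))
    ≡⟨ cong₂ _+_ (sum-map-∘ G FZ (picks Y)) (sum-map-∘ G FY (picks Z)) ⟩
  sum (map (G ∘ FZ) (picks Y)) + sum (map (G ∘ FY) (picks Z)) ∎
  where
  open ≡-Reasoning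
  FZ FY : ℕ × List ℕ → ℕ × List ℕ
  FZ p = proj₁ p , proj₂ p ++ Z
  FY p = proj₁ p , Y ++ proj₂ p

-- A linear extension of two mutually unrelated parts is a shuffle of linear extensions of the parts.
module Shuffle (ρ : BoolRel) (PY PZ : ℕ → Set) (unrelated : Unrelated ρ PY PZ) where

  ShuffleAt : ℕ → Set
  ShuffleAt n = ∀ Y Z → length Y + length Z ≡ n → All PY Y → All PZ Z →
                linExt ρ (Y ++ Z) ≡ ((length Y + length Z) C length Y) * linExt ρ Y * linExt ρ Z

  minimum-left : ∀ {n} → ShuffleAt n → ∀ x r Z m → PY x → All PY r → All PZ Z → length r ≡ m → m + length Z ≡ n →
    (if isMinimal ρ x (r ++ Z) then linExtN n ρ (r ++ Z) else 0) ≡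
    ((m + length Z) C m) * linExt ρ Z * (if isMinimal ρ x r then linExtN m ρ r else 0)
  minimum-left {n} IH x r Z m px pr pZ refl len
    rewrite isMinimal-++ʳ ρ x r Z (All.map (λ pz → proj₂ (unrelated x _ px pz)) pZ) with isMinimal ρ x r
  ... | false = sym (*-zeroʳ (((length r + length Z) C length r) * linExt ρ Z))
  ... | true  = begin
    linExtN n ρ (r ++ Z)
      ≡⟨ cong (λ k → linExtN k ρ (r ++ Z)) (trans (sym len) (sym (length-++ r))) ⟩
    linExt ρ (r ++ Z)
      ≡⟨ IH r Z len pr pZ ⟩
    ((length r + length Z) C length r) * linExt ρ r * linExt ρ Z
      ≡⟨ xy∙z≈xz∙y ((length r + length Z) C length r) (linExt ρ r) (linExt ρ Z) ⟩
    ((length r + length Z) C length r) * linExt ρ Z * linExt ρ r ∎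
    where open ≡-Reasoning

  minimum-right : ∀ {n} → ShuffleAt n → ∀ x Y r m → PZ x → All PY Y → All PZ r → length r ≡ m → length Y + m ≡ n →
    (if isMinimal ρ x (Y ++ r) then linExtN n ρ (Y ++ r) else 0) ≡
    ((length Y + m) C length Y) * linExt ρ Y * (if isMinimal ρ x r then linExtN m ρ r else 0)
  minimum-right {n} IH x Y r m px pY pr refl len
    rewrite isMinimal-++ˡ ρ x Y r (All.map (λ py → proj₁ (unrelated _ x py px)) pY) with isMinimal ρ x r
  ... | false = sym (*-zeroʳ (((length Y + length r) C length Y) * linExt ρ Y))
  ... | true  = trans (cong (λ k → linExtN k ρ (Y ++ r)) (trans (sym len) (sym (length-++ Y)))) (IH Y r len pY pr)

  shuffle : ∀ n → ShuffleAt n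
  shuffle n [] Z _ _ _ = sym (trans (cong (_* linExt ρ Z) (*-identityʳ (length Z C 0))) (*-identityˡ (linExt ρ Z)))
  shuffle n (y ∷ Y) [] _ _ _ rewrite ++-identityʳ Y | +-identityʳ (length Y) | nCn≡1 (suc (length Y)) =
    sym (trans (*-identityʳ _) (+-identityʳ _))
  shuffle zero    (y ∷ Y) (z ∷ Z) () _ _
  shuffle (suc n) (y ∷ Y) (z ∷ Z) len pYf@(py ∷ pY) pZf@(pz ∷ pZ) = begin
    linExtN (suc (length (Y ++ Zf))) ρ (Yf ++ Zf)
      ≡⟨ cong (λ k → linExtN k ρ (Yf ++ Zf)) (trans (cong suc (length-++ Y)) len) ⟩
    sum (map G (picks (Yf ++ Zf)))
      ≡⟨ sum-picks-++ G Yf Zf ⟩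
    sum (map (λ p → G (proj₁ p , proj₂ p ++ Zf)) (picks Yf)) + sum (map (λ p → G (proj₁ p , Yf ++ proj₂ p)) (picks Zf))
      ≡⟨ cong₂ _+_
           (trans (cong sum (map-cong-local (All.map (λ { (px , pr , lr) →
                    minimum-left (shuffle n) _ _ Zf a px pr pZf (suc-injective lr) (sym n≡) })
                                                     (All-picks Yf pYf))))
                  (sum-map-*ˡ (C1 * linExt ρ Zf) _ (picks Yf)))
           (trans (cong sum (map-cong-local (All.map (λ { (px , pr , lr) →
                    minimum-right (shuffle n) _ Yf _ b px pYf pr (suc-injective lr) (sym n≡′) })
                                                     (All-picks Zf pZf))))
                  (sum-map-*ˡ (C2 * linExt ρ Yf) _ (picks Zf))) ⟩
    C1 * linExt ρ Zf * linExt ρ Yf + C2 * linExt ρ Yf * linExt ρ Zf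
      ≡⟨ collect C1 C2 (linExt ρ Yf) (linExt ρ Zf) ⟩
    (C1 + C2) * linExt ρ Yf * linExt ρ Zf
      ≡⟨ cong (λ c → c * linExt ρ Yf * linExt ρ Zf) (pascal a b) ⟩
    ((length Yf + length Zf) C length Yf) * linExt ρ Yf * linExt ρ Zf ∎
    where
    open ≡-Reasoning
    Yf = y ∷ Y
    Zf = z ∷ Z
    a = length Y
    b = length Z
    C1 = (a + length Zf) C a
    C2 = (length Yf + b) C length Yf
    n≡ : n ≡ a + suc b
    n≡ = sym (suc-injective len)
    n≡′ : n ≡ suc a + b
    n≡′ = trans n≡ (+-suc a b)
    G : ℕ × List ℕ → ℕ
    G p = if isMinimal ρ (proj₁ p) (proj₂ p) then linExtN n ρ (proj₂ p) else 0
    collect : ∀ c d y z → c * z * y + d * y * z ≡ (c + d) * y * z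
    collect = solve-∀

linExt-++ : ∀ ρ (PY PZ : ℕ → Set) Y Z → All PY Y → All PZ Z → Unrelated ρ PY PZ →
            linExt ρ (Y ++ Z) ≡ ((length Y + length Z) C length Y) * linExt ρ Y * linExt ρ Z
linExt-++ ρ PY PZ Y Z pY pZ unrelated = Shuffle.shuffle ρ PY PZ unrelated _ Y Z refl pY pZ

-- The zigzag on 0, …, m-1 with steps w: i < i+1 if w i, and i+1 < i otherwise.
zigzag : (ℕ → Bool) → BoolRel
zigzag w a b = ((suc a ≡ᵇ b) ∧ w a) ∨ ((suc b ≡ᵇ a) ∧ not (w b))

zigzagExt : (ℕ → Bool) → ℕ → ℕ
zigzagExt w m = linExt (zigzag w) (upTo m)

zigzagExt-cong : ∀ w w′ m → (∀ i → w i ≡ w′ i) → zigzagExt w m ≡ zigzagExt w′ m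
zigzagExt-cong w w′ m e = linExt-cong _ _ (upTo m) related
  where
  related : ∀ a b → zigzag w a b ≡ zigzag w′ a b
  related a b rewrite e a | e b = refl

+-≡ᵇ-cancelˡ : ∀ k a b → (k + a ≡ᵇ k + b) ≡ (a ≡ᵇ b)
+-≡ᵇ-cancelˡ zero    a b = refl
+-≡ᵇ-cancelˡ (suc k) a b = +-≡ᵇ-cancelˡ k a b

zigzag-shift : ∀ w k a b → (zigzag w on (k +_)) a b ≡ zigzag (w ∘ (k +_)) a b
zigzag-shift w k a b rewrite sym (+-suc k a) | sym (+-suc k b) | +-≡ᵇ-cancelˡ k (suc a) b | +-≡ᵇ-cancelˡ k (suc b) a = refl

zigzag-unrelated : ∀ w v → Unrelated (zigzag w) (_< v) (v <_)
zigzag-unrelated w v a b a<v v<b rewrite <⇒≡ᵇ-false (<-≤-trans (s≤s a<v) v<b)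
                                        | >⇒≡ᵇ-false (≤-trans (<-trans a<v v<b) (n≤1+n b)) = refl , refl

length-upToWithout : ∀ v m → v ≤ m → length (upToWithout v m) ≡ m
length-upToWithout v m v≤m = begin
  length (upTo v ++ map (suc v +_) (upTo (m ∸ v)))    ≡⟨ length-++ (upTo v) ⟩
  length (upTo v) + length (map (suc v +_) (upTo (m ∸ v)))
    ≡⟨ cong₂ _+_ (length-upTo v) (trans (length-map _ (upTo (m ∸ v))) (length-upTo (m ∸ v))) ⟩
  v + (m ∸ v)                                          ≡⟨ m+[n∸m]≡n v≤m ⟩
  m                                                    ∎
  where open ≡-Reasoning

-- Removing the element v from a zigzag leaves two unrelated zigzags.
linExtN-zigzag-without : ∀ w v m → v ≤ m →
  linExtN m (zigzag w) (upToWithout v m) ≡ (m C v) * zigzagExt w v * zigzagExt (w ∘ (suc v +_)) (m ∸ v)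
linExtN-zigzag-without w v m v≤m = begin
  linExtN m (zigzag w) (upToWithout v m)
    ≡⟨ cong (λ k → linExtN k (zigzag w) (upToWithout v m)) (length-upToWithout v m v≤m) ⟨
  linExt (zigzag w) (upTo v ++ Z)
    ≡⟨ linExt-++ (zigzag w) (_< v) (v <_) (upTo v) Z (all-upTo v)
                 (map⁺ (All.universal (λ i → s≤s (m≤m+n v i)) (upTo (m ∸ v)))) (zigzag-unrelated w v) ⟩
  ((length (upTo v) + length Z) C length (upTo v)) * zigzagExt w v * linExt (zigzag w) Z
    ≡⟨ cong₂ (λ c e → c * zigzagExt w v * e) (cong₂ _C_ lengths (length-upTo v)) right ⟩
  (m C v) * zigzagExt w v * zigzagExt (w ∘ (suc v +_)) (m ∸ v) ∎
  where
  open ≡-Reasoning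
  Z = map (suc v +_) (upTo (m ∸ v))
  lengths : length (upTo v) + length Z ≡ m
  lengths = trans (cong₂ _+_ (length-upTo v) (trans (length-map _ (upTo (m ∸ v))) (length-upTo (m ∸ v)))) (m+[n∸m]≡n v≤m)
  right : linExt (zigzag w) Z ≡ zigzagExt (w ∘ (suc v +_)) (m ∸ v)
  right = trans (linExt-map (zigzag w) (suc v +_) (upTo (m ∸ v))) (linExt-cong _ _ (upTo (m ∸ v)) (zigzag-shift w (suc v)))

-- Whether v lies above its left, resp. right, neighbour; L is the number of positions to the right of v.
aboveLeft : (ℕ → Bool) → ℕ → Bool
aboveLeft w zero    = false
aboveLeft w (suc v) = w v

aboveRight : (ℕ → Bool) → ℕ → ℕ → Bool
aboveRight w v zero    = false
aboveRight w v (suc L) = not (w v)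

any-zigzag-left : ∀ w v → any (λ y → (suc y ≡ᵇ v) ∧ w y) (upTo v) ≡ aboveLeft w v
any-zigzag-left w zero    = refl
any-zigzag-left w (suc v) =
  trans (cong (any (λ y → (suc y ≡ᵇ suc v) ∧ w y)) (upTo-suc v))
        (trans (cong (((1 ≡ᵇ suc v) ∧ w 0) ∨_) (trans (any-map _ suc (upTo v)) (any-zigzag-left (w ∘ suc) v))) (last v))
  where
  last : ∀ v → ((0 ≡ᵇ v) ∧ w 0) ∨ aboveLeft (w ∘ suc) v ≡ w v
  last zero    = ∨-identityʳ (w 0)
  last (suc v) = refl

any-zigzag-right : ∀ w v L → any (λ i → (0 ≡ᵇ i) ∧ not (w v)) (upTo L) ≡ aboveRight w v L
any-zigzag-right w v zero    = refl
any-zigzag-right w v (suc L) =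
  trans (cong (any (λ i → (0 ≡ᵇ i) ∧ not (w v))) (upTo-suc L))
        (trans (cong (not (w v) ∨_) (trans (any-map _ suc (upTo L)) (any-false _ (upTo L) (All.universal (λ _ → refl) (upTo L)))))
               (∨-identityʳ (not (w v))))

isMinimal-zigzag : ∀ w v m → v ≤ m →
  isMinimal (zigzag w) v (upToWithout v m) ≡ not (aboveLeft w v) ∧ not (aboveRight w v (m ∸ v))
isMinimal-zigzag w v m v≤m = begin
  not (zigzag w v v ∨ any (λ y → zigzag w y v) (upTo v ++ map (suc v +_) (upTo (m ∸ v))))
    ≡⟨ cong₂ (λ a b → not (a ∨ b)) irreflexive (any-++ _ (upTo v) _) ⟩
  not (any (λ y → zigzag w y v) (upTo v) ∨ any (λ y → zigzag w y v) (map (suc v +_) (upTo (m ∸ v))))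
    ≡⟨ cong₂ (λ a b → not (a ∨ b)) (trans (any-cong (upTo v) (All.map left (all-upTo v))) (any-zigzag-left w v))
            (trans (any-map _ _ (upTo (m ∸ v))) (trans (any-cong (upTo (m ∸ v)) (All.universal right _))
                                                       (any-zigzag-right w v (m ∸ v)))) ⟩
  not (aboveLeft w v ∨ aboveRight w v (m ∸ v))
    ≡⟨ deMorgan (aboveLeft w v) _ ⟩
  not (aboveLeft w v) ∧ not (aboveRight w v (m ∸ v)) ∎
  where
  open ≡-Reasoning
  deMorgan : ∀ a b → not (a ∨ b) ≡ not a ∧ not b
  deMorgan true  b = refl
  deMorgan false b = refl
  irreflexive : zigzag w v v ≡ false
  irreflexive rewrite >⇒≡ᵇ-false (n<1+n v) = refl
  left : ∀ {y} → y < v → zigzag w y v ≡ ((suc y ≡ᵇ v) ∧ w y)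
  left {y} y<v rewrite >⇒≡ᵇ-false {suc v} {y} (≤-trans y<v (n≤1+n v)) = ∨-identityʳ _
  right : ∀ i → zigzag w (suc v + i) v ≡ ((0 ≡ᵇ i) ∧ not (w v))
  right i rewrite >⇒≡ᵇ-false {suc (suc (v + i))} {v} (s≤s (≤-trans (m≤m+n v i) (n≤1+n (v + i))))
                | subst (λ z → (z ≡ᵇ v + i) ≡ (0 ≡ᵇ i)) (+-identityʳ v) (+-≡ᵇ-cancelˡ v 0 i) = refl

minimumAt : (ℕ → Bool) → ℕ → ℕ → ℕ
minimumAt w m v = if not (aboveLeft w v) ∧ not (aboveRight w v (m ∸ v))
                  then (m C v) * zigzagExt w v * zigzagExt (w ∘ (suc v +_)) (m ∸ v) else 0

-- Sum over the position v of the minimum label: v must be a valley, and removing it splits the zigzag.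
zigzagExt-suc : ∀ w m → zigzagExt w (suc m) ≡ sum (map (minimumAt w m) (upTo (suc m)))
zigzagExt-suc w m = trans (linExt-upTo-suc m (zigzag w))
  (cong sum (map-cong-local (All.map (λ v<sm → atMinimum _ (≤-pred v<sm)) (all-upTo (suc m)))))
  where
  atMinimum : ∀ v → v ≤ m →
              (if isMinimal (zigzag w) v (upToWithout v m) then linExtN m (zigzag w) (upToWithout v m) else 0) ≡ minimumAt w m v
  atMinimum v v≤m = cong₂ (λ b e → if b then e else 0) (isMinimal-zigzag w v m v≤m) (linExtN-zigzag-without w v m v≤m)

minimumAt-aboveLeft : ∀ w m v → aboveLeft w v ≡ true → minimumAt w m v ≡ 0
minimumAt-aboveLeft w m v e rewrite e = refl

aboveRight-up : ∀ w v L → w v ≡ true → aboveRight w v L ≡ false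
aboveRight-up w v zero    _  = refl
aboveRight-up w v (suc L) up rewrite up = refl

minimumAt-valley : ∀ w m v → aboveLeft w v ≡ false → w v ≡ true →
                   minimumAt w m v ≡ (m C v) * zigzagExt w v * zigzagExt (w ∘ (suc v +_)) (m ∸ v)
minimumAt-valley w m v left up rewrite left | aboveRight-up w v (m ∸ v) up = refl

-- Steps of the zigzag s < ℓ₁ > r₁ < q₁ < ℓ₂ > r₂ < q₂ < ⋯ (period up, down, up);
-- dropping s gives those of ℓ₁ > r₁ < q₁ < ⋯.
stepsS : ℕ → Bool
stepsS zero                = true
stepsS (suc zero)          = false
stepsS (suc (suc zero))    = true
stepsS (suc (suc (suc i))) = stepsS i

stepsA : ℕ → Bool
stepsA i = stepsS (suc i)

3*-suc : ∀ t → 3 * suc t ≡ suc (suc (suc (3 * t)))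
3*-suc = solve-∀

stepsS-3t : ∀ t → stepsS (3 * t) ≡ true
stepsS-3t zero    = refl
stepsS-3t (suc t) = subst (λ k → stepsS k ≡ true) (sym (3*-suc t)) (stepsS-3t t)

stepsS-3t+1 : ∀ t → stepsS (suc (3 * t)) ≡ false
stepsS-3t+1 zero    = refl
stepsS-3t+1 (suc t) = subst (λ k → stepsS (suc k) ≡ false) (sym (3*-suc t)) (stepsS-3t+1 t)

stepsS-3t+2 : ∀ t → stepsS (suc (suc (3 * t))) ≡ true
stepsS-3t+2 zero    = refl
stepsS-3t+2 (suc t) = subst (λ k → stepsS (suc (suc k)) ≡ true) (sym (3*-suc t)) (stepsS-3t+2 t)

stepsS-periodic : ∀ t i → stepsS (3 * t + i) ≡ stepsS i
stepsS-periodic zero    i = refl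
stepsS-periodic (suc t) i = subst (λ k → stepsS (k + i) ≡ stepsS i) (sym (3*-suc t)) (stepsS-periodic t i)

sum-upTo-3* : ∀ (H : ℕ → ℕ) n →
  sum (map H (upTo (3 * n))) ≡ sum (map (λ t → H (3 * t) + (H (suc (3 * t)) + H (suc (suc (3 * t))))) (upTo n))
sum-upTo-3* H zero    = refl
sum-upTo-3* H (suc n) = begin
  sum (map H (upTo (3 * suc n)))
    ≡⟨ cong (sum ∘ map H ∘ upTo) (3*-suc n) ⟩
  sum (map H (upTo (suc (suc (suc (3 * n))))))
    ≡⟨ trans (sum-upTo-sucʳ H _)
             (cong (_+ H (suc (suc (3 * n)))) (trans (sum-upTo-sucʳ H _) (cong (_+ H (suc (3 * n))) (sum-upTo-sucʳ H _)))) ⟩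
  sum (map H (upTo (3 * n))) + H (3 * n) + H (suc (3 * n)) + H (suc (suc (3 * n)))
    ≡⟨ reassoc (sum (map H (upTo (3 * n)))) (H (3 * n)) _ _ ⟩
  sum (map H (upTo (3 * n))) + block n
    ≡⟨ cong (_+ block n) (sum-upTo-3* H n) ⟩
  sum (map block (upTo n)) + block n
    ≡⟨ sum-upTo-sucʳ block n ⟨
  sum (map block (upTo (suc n))) ∎
  where
  open ≡-Reasoning
  block : ℕ → ℕ
  block t = H (3 * t) + (H (suc (3 * t)) + H (suc (suc (3 * t))))
  reassoc : ∀ a b c d → a + b + c + d ≡ a + (b + (c + d))
  reassoc = solve-∀

∸-via-split : ∀ {t n} (m v r : ℕ → ℕ) → t < n → (∀ t d → m (suc t + d) ≡ v t + r d) → m n ∸ v t ≡ r (n ∸ suc t)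
∸-via-split {t} {n} m v r t<n split = subst (λ k → m k ∸ v t ≡ r (n ∸ suc t)) (m+[n∸m]≡n t<n)
  (trans (cong (_∸ v t) (split t (n ∸ suc t))) (m+n∸m≡n (v t) _))


-- Each shrub has exactly one valley, its root, and the zigzag to the right of it is again of one of the four kinds.
termB termS termE termA : ℕ → ℕ → ℕ
termB n t = (suc (3 * n) C suc (suc (3 * t))) * zigzagExt stepsS (suc (suc (3 * t))) * zigzagExt stepsS (suc (suc (3 * (n ∸ suc t))))
termS n t = (3 * n C suc (suc (3 * t))) * zigzagExt stepsS (suc (suc (3 * t))) * zigzagExt stepsS (suc (3 * (n ∸ suc t)))
termE n t = (3 * n C suc (3 * t)) * zigzagExt stepsA (suc (3 * t)) * zigzagExt stepsS (suc (suc (3 * (n ∸ suc t))))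
termA n t = ((3 * n ∸ 1) C suc (3 * t)) * zigzagExt stepsA (suc (3 * t)) * zigzagExt stepsS (suc (3 * (n ∸ suc t)))

recurrenceB : ∀ n → zigzagExt stepsS (suc (suc (3 * n))) ≡ zigzagExt stepsA (suc (3 * n)) + sum (map (termB n) (upTo n))
recurrenceB n = begin
  zigzagExt stepsS (suc m)
    ≡⟨ zigzagExt-suc stepsS m ⟩
  sum (map (minimumAt stepsS m) (upTo (suc m)))
    ≡⟨ sum-upTo-suc (minimumAt stepsS m) m ⟩
  minimumAt stepsS m 0 + sum (map H (upTo m))
    ≡⟨ cong₂ _+_ (+-identityʳ _) (sum-upTo-sucʳ H (3 * n)) ⟩
  zigzagExt stepsA m + (sum (map H (upTo (3 * n))) + H (3 * n))
    ≡⟨ cong (λ z → zigzagExt stepsA m + (z + H (3 * n))) (sum-upTo-3* H n) ⟩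
  zigzagExt stepsA m + (sum (map (λ t → H (3 * t) + (H (suc (3 * t)) + H (suc (suc (3 * t))))) (upTo n)) + H (3 * n))
    ≡⟨ cong₂ (λ a b → zigzagExt stepsA m + (a + b)) (cong sum (map-cong-local (All.map block (all-upTo n))))
                                                    (minimumAt-aboveLeft stepsS m (suc (3 * n)) (stepsS-3t n)) ⟩
  zigzagExt stepsA m + (sum (map (termB n) (upTo n)) + 0)
    ≡⟨ cong (zigzagExt stepsA m +_) (+-identityʳ _) ⟩
  zigzagExt stepsA m + sum (map (termB n) (upTo n)) ∎
  where
  open ≡-Reasoning
  m = suc (3 * n)
  H : ℕ → ℕ
  H p = minimumAt stepsS m (suc p)
  block : ∀ {t} → t < n → H (3 * t) + (H (suc (3 * t)) + H (suc (suc (3 * t)))) ≡ termB n t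
  block {t} t<n = begin
    H (3 * t) + (H (suc (3 * t)) + H v)
      ≡⟨ cong₂ (λ a b → a + (b + H v)) (minimumAt-aboveLeft stepsS m (suc (3 * t)) (stepsS-3t t))
                                       (minimumAt-valley stepsS m v (stepsS-3t+1 t) (stepsS-3t+2 t)) ⟩
    (m C v) * zigzagExt stepsS v * zigzagExt (stepsS ∘ (suc v +_)) (m ∸ v) + H v
      ≡⟨ cong₂ (λ a b → (m C v) * zigzagExt stepsS v * a + b) right (minimumAt-aboveLeft stepsS m (suc v) (stepsS-3t+2 t)) ⟩
    termB n t + 0
      ≡⟨ +-identityʳ _ ⟩
    termB n t ∎
    where
    v = suc (suc (3 * t))
    right : zigzagExt (stepsS ∘ (suc v +_)) (m ∸ v) ≡ zigzagExt stepsS (suc (suc (3 * (n ∸ suc t))))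
    right = trans (zigzagExt-cong _ stepsS (m ∸ v) (stepsS-periodic t))
                  (cong (zigzagExt stepsS)
                        (∸-via-split (λ n → suc (3 * n)) (λ t → suc (suc (3 * t))) (λ d → suc (suc (3 * d))) t<n solve-∀))

recurrenceS : ∀ n → zigzagExt stepsS (suc (3 * n)) ≡ zigzagExt stepsA (3 * n) + sum (map (termS n) (upTo n))
recurrenceS n = begin
  zigzagExt stepsS (suc m)
    ≡⟨ zigzagExt-suc stepsS m ⟩
  sum (map (minimumAt stepsS m) (upTo (suc m)))
    ≡⟨ sum-upTo-suc (minimumAt stepsS m) m ⟩
  minimumAt stepsS m 0 + sum (map H (upTo m))
    ≡⟨ cong₂ _+_ (trans (minimumAt-valley stepsS m 0 refl refl) (+-identityʳ _)) (sum-upTo-3* H n) ⟩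
  zigzagExt stepsA m + sum (map (λ t → H (3 * t) + (H (suc (3 * t)) + H (suc (suc (3 * t))))) (upTo n))
    ≡⟨ cong (zigzagExt stepsA m +_) (cong sum (map-cong-local (All.map block (all-upTo n)))) ⟩
  zigzagExt stepsA m + sum (map (termS n) (upTo n)) ∎
  where
  open ≡-Reasoning
  m = 3 * n
  H : ℕ → ℕ
  H p = minimumAt stepsS m (suc p)
  block : ∀ {t} → t < n → H (3 * t) + (H (suc (3 * t)) + H (suc (suc (3 * t)))) ≡ termS n t
  block {t} t<n = begin
    H (3 * t) + (H (suc (3 * t)) + H v)
      ≡⟨ cong₂ (λ a b → a + (b + H v)) (minimumAt-aboveLeft stepsS m (suc (3 * t)) (stepsS-3t t))
                                       (minimumAt-valley stepsS m v (stepsS-3t+1 t) (stepsS-3t+2 t)) ⟩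
    (m C v) * zigzagExt stepsS v * zigzagExt (stepsS ∘ (suc v +_)) (m ∸ v) + H v
      ≡⟨ cong₂ (λ a b → (m C v) * zigzagExt stepsS v * a + b) right (minimumAt-aboveLeft stepsS m (suc v) (stepsS-3t+2 t)) ⟩
    termS n t + 0
      ≡⟨ +-identityʳ _ ⟩
    termS n t ∎
    where
    v = suc (suc (3 * t))
    right : zigzagExt (stepsS ∘ (suc v +_)) (m ∸ v) ≡ zigzagExt stepsS (suc (3 * (n ∸ suc t)))
    right = trans (zigzagExt-cong _ stepsS (m ∸ v) (stepsS-periodic t))
                  (cong (zigzagExt stepsS) (∸-via-split (3 *_) (λ t → suc (suc (3 * t))) (λ d → suc (3 * d)) t<n solve-∀))

recurrenceE : ∀ n → 1 ≤ n → zigzagExt stepsA (suc (3 * n)) ≡ sum (map (termE n) (upTo n))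
recurrenceE n@(suc _) _ = begin
  zigzagExt stepsA (suc m)
    ≡⟨ zigzagExt-suc stepsA m ⟩
  sum (map (minimumAt stepsA m) (upTo (suc m)))
    ≡⟨ sum-upTo-suc (minimumAt stepsA m) m ⟩
  0 + sum (map H (upTo m))
    ≡⟨ sum-upTo-3* H n ⟩
  sum (map (λ t → H (3 * t) + (H (suc (3 * t)) + H (suc (suc (3 * t))))) (upTo n))
    ≡⟨ cong sum (map-cong-local (All.map block (all-upTo n))) ⟩
  sum (map (termE n) (upTo n)) ∎
  where
  open ≡-Reasoning
  m = 3 * n
  H : ℕ → ℕ
  H p = minimumAt stepsA m (suc p)
  block : ∀ {t} → t < n → H (3 * t) + (H (suc (3 * t)) + H (suc (suc (3 * t)))) ≡ termE n t
  block {t} t<n = begin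
    H (3 * t) + (H v + H (suc v))
      ≡⟨ cong₂ (λ a b → a + (b + H (suc v))) (minimumAt-valley stepsA m v (stepsS-3t+1 t) (stepsS-3t+2 t))
                                             (minimumAt-aboveLeft stepsA m (suc v) (stepsS-3t+2 t)) ⟩
    (m C v) * zigzagExt stepsA v * zigzagExt (stepsA ∘ (suc v +_)) (m ∸ v) + (0 + H (suc v))
      ≡⟨ cong₂ (λ a b → (m C v) * zigzagExt stepsA v * a + b) right (minimumAt-aboveLeft stepsA m (suc (suc v)) (stepsS-3t t)) ⟩
    termE n t + 0
      ≡⟨ +-identityʳ _ ⟩
    termE n t ∎
    where
    v = suc (3 * t)
    right : zigzagExt (stepsA ∘ (suc v +_)) (m ∸ v) ≡ zigzagExt stepsS (suc (suc (3 * (n ∸ suc t))))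
    right = trans (zigzagExt-cong _ stepsS (m ∸ v) (stepsS-periodic t))
                  (cong (zigzagExt stepsS) (∸-via-split (3 *_) (λ t → suc (3 * t)) (λ d → suc (suc (3 * d))) t<n solve-∀))

recurrenceA : ∀ n → 1 ≤ n → zigzagExt stepsA (3 * n) ≡ sum (map (termA n) (upTo n))
recurrenceA n@(suc n′) _ = begin
  zigzagExt stepsA (suc m)
    ≡⟨ zigzagExt-suc stepsA m ⟩
  sum (map (minimumAt stepsA m) (upTo (suc m)))
    ≡⟨ sum-upTo-suc (minimumAt stepsA m) m ⟩
  minimumAt stepsA m 0 + sum (map H (upTo m))
    ≡⟨ cong₂ (λ k l → minimumAt stepsA k 0 + sum (map H (upTo l))) m≡ m≡ ⟩
  sum (map H (upTo (suc (suc (3 * n′)))))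
    ≡⟨ trans (sum-upTo-sucʳ H (suc (3 * n′))) (cong (_+ H (suc (3 * n′))) (sum-upTo-sucʳ H (3 * n′))) ⟩
  sum (map H (upTo (3 * n′))) + H (3 * n′) + H (suc (3 * n′))
    ≡⟨ cong₂ (λ a b → a + b + H (suc (3 * n′))) (sum-upTo-3* H n′) (valley n′ ≤-refl) ⟩
  sum (map (λ t → H (3 * t) + (H (suc (3 * t)) + H (suc (suc (3 * t))))) (upTo n′)) + termA n n′ + H (suc (3 * n′))
    ≡⟨ cong₂ (λ a b → a + termA n n′ + b) (cong sum (map-cong-local (All.map block (all-upTo n′))))
                                          (minimumAt-aboveLeft stepsA m (suc (suc (3 * n′))) (stepsS-3t+2 n′)) ⟩
  sum (map (termA n) (upTo n′)) + termA n n′ + 0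
    ≡⟨ trans (+-identityʳ _) (sym (sum-upTo-sucʳ (termA n) n′)) ⟩
  sum (map (termA n) (upTo n)) ∎
  where
  open ≡-Reasoning
  m = 3 * n ∸ 1
  m≡ : m ≡ suc (suc (3 * n′))
  m≡ = cong (_∸ 1) (3*-suc n′)
  H : ℕ → ℕ
  H p = minimumAt stepsA m (suc p)
  valley : ∀ t → t < n → H (3 * t) ≡ termA n t
  valley t t<n = trans (minimumAt-valley stepsA m (suc (3 * t)) (stepsS-3t+1 t) (stepsS-3t+2 t))
    (cong ((m C suc (3 * t)) * zigzagExt stepsA (suc (3 * t)) *_)
          (trans (zigzagExt-cong _ stepsS (m ∸ suc (3 * t)) (stepsS-periodic t))
                 (cong (zigzagExt stepsS) (∸-via-split (λ n → 3 * n ∸ 1) (λ t → suc (3 * t)) (λ d → suc (3 * d)) t<n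
                                                        (λ t d → cong (_∸ 1) (split t d))))))
    where
    split : ∀ t d → 3 * (suc t + d) ≡ suc (suc (3 * t) + suc (3 * d))
    split = solve-∀
  block : ∀ {t} → t < n′ → H (3 * t) + (H (suc (3 * t)) + H (suc (suc (3 * t)))) ≡ termA n t
  block {t} t<n′ = trans (cong₂ _+_ (valley t (≤-trans t<n′ (n≤1+n n′)))
      (cong₂ _+_ (minimumAt-aboveLeft stepsA m (suc (suc (3 * t))) (stepsS-3t+2 t))
                 (minimumAt-aboveLeft stepsA m (suc (suc (suc (3 * t)))) (stepsS-3t t)))) (+-identityʳ _)

relᵇ : List (ℕ × ℕ) → BoolRel
relᵇ R a b = any (λ p → (proj₁ p ≡ᵇ a) ∧ (proj₂ p ≡ᵇ b)) R

relᵇ-++ : ∀ R E x y → relᵇ (R ++ E) x y ≡ relᵇ R x y ∨ relᵇ E x y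
relᵇ-++ R E x y = any-++ _ R E

relᵇ-∷⁻ : ∀ c d E x y → relᵇ ((c , d) ∷ E) x y ≡ true → (c ≡ x × d ≡ y) ⊎ relᵇ E x y ≡ true
relᵇ-∷⁻ c d E x y h with ∨-≡true⁻ {(c ≡ᵇ x) ∧ (d ≡ᵇ y)} h
... | inj₁ e = inj₁ (≡ᵇ-true⇒≡ _ _ (proj₁ (∧-≡true⁻ e)) , ≡ᵇ-true⇒≡ _ _ (proj₂ (∧-≡true⁻ {c ≡ᵇ x} e)))
... | inj₂ e = inj₂ e

relᵇ-here : ∀ c d E → relᵇ ((c , d) ∷ E) c d ≡ true
relᵇ-here c d E rewrite ≡ᵇ-refl c | ≡ᵇ-refl d = refl

relᵇ-there : ∀ c d E x y → relᵇ E x y ≡ true → relᵇ ((c , d) ∷ E) x y ≡ true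
relᵇ-there c d E x y e = ∨-≡trueʳ ((c ≡ᵇ x) ∧ (d ≡ᵇ y)) e

relᵇ-self : ∀ R → All (λ p → relᵇ R (proj₁ p) (proj₂ p) ≡ true) R
relᵇ-self []            = []
relᵇ-self ((c , d) ∷ R) = relᵇ-here c d R ∷ All.map (relᵇ-there c d R _ _) (relᵇ-self R)

preserves-sound : ∀ R L a b → preserves R L ≡ true → relᵇ R a b ≡ true → nth L a < nth L b
preserves-sound ((c , d) ∷ R) L a b h r with (c ≡ᵇ a) ∧ (d ≡ᵇ b) in e
... | true  = let c≡a , d≡b = ∧-≡true⁻ e in
  subst₂ (λ x y → nth L x < nth L y) (≡ᵇ-true⇒≡ c a c≡a) (≡ᵇ-true⇒≡ d b d≡b) (<ᵇ-true⇒< _ _ (proj₁ (∧-≡true⁻ h)))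
... | false = preserves-sound R L a b (proj₂ (∧-≡true⁻ {nth L c <ᵇ nth L d} h)) r

preserves-complete : ∀ R L → All (λ p → nth L (proj₁ p) < nth L (proj₂ p)) R → preserves R L ≡ true
preserves-complete []            L []       = refl
preserves-complete ((c , d) ∷ R) L (p ∷ ps) rewrite <⇒<ᵇ-true p = preserves-complete R L ps

InRange : ℕ → List (ℕ × ℕ) → Set
InRange N R = All (λ p → proj₁ p < N × proj₂ p < N) R

preserves≡preservesᵇ : ∀ N R L → InRange N R → preserves R L ≡ preservesᵇ N (relᵇ R) L
preserves≡preservesᵇ N R L inRange = bool-ext
  (λ h → preservesᵇ-complete N (relᵇ R) L (λ a b _ _ r → preserves-sound R L a b h r))
  (λ h → preserves-complete R L (pairs R inRange (relᵇ-self R) (preservesᵇ-sound N (relᵇ R) L h)))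
  where
  pairs : ∀ R′ → InRange N R′ → All (λ p → relᵇ R (proj₁ p) (proj₂ p) ≡ true) R′ → OrderPreserving N (relᵇ R) L →
          All (λ p → nth L (proj₁ p) < nth L (proj₂ p)) R′
  pairs []             []                []       P = []
  pairs ((c , d) ∷ R′) ((c< , d<) ∷ bs) (r ∷ rs) P = P c d c< d< r ∷ pairs R′ bs rs P

sum≥length : ∀ xs → All (1 ≤_) xs → length xs ≤ sum xs
sum≥length []       []       = z≤n
sum≥length (x ∷ xs) (p ∷ ps) = +-mono-≤ p (sum≥length xs ps)

sum≤length⇒≡1 : ∀ xs → All (1 ≤_) xs → sum xs ≤ length xs → All (_≡ 1) xs
sum≤length⇒≡1 []       []       _ = []
sum≤length⇒≡1 (x ∷ xs) (p ∷ ps) h =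
  ≤-antisym x≤1 p ∷ sum≤length⇒≡1 xs ps (≤-pred (≤-trans (+-monoˡ-≤ (sum xs) p) h))
  where
  x≤1 : x ≤ 1
  x≤1 = +-cancelʳ-≤ (sum xs) x 1 (≤-trans h (s≤s (sum≥length xs ps)))

count-≡ᵇ-upTo : ∀ N y → sum (map (λ i → [ i ≡ᵇ y ]ᵇ) (upTo N)) ≡ (if y <ᵇ N then 1 else 0)
count-≡ᵇ-upTo zero    y = refl
count-≡ᵇ-upTo (suc N) y =
  trans (sum-upTo-sucʳ (λ i → [ i ≡ᵇ y ]ᵇ) N) (trans (cong (_+ [ N ≡ᵇ y ]ᵇ) (count-≡ᵇ-upTo N y)) (last (<-cmp y N)))
  where
  last : Tri (y < N) (y ≡ N) (N < y) → (if y <ᵇ N then 1 else 0) + [ N ≡ᵇ y ]ᵇ ≡ (if y <ᵇ suc N then 1 else 0)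
  last (tri< y<N _ _) rewrite <⇒<ᵇ-true y<N | <⇒<ᵇ-true (≤-trans y<N (n≤1+n N)) | >⇒≡ᵇ-false y<N = refl
  last (tri≈ _ refl _) rewrite ≥⇒<ᵇ-false (≤-refl {y}) | <⇒<ᵇ-true (n<1+n y) | ≡ᵇ-refl y = refl
  last (tri> _ _ N<y) rewrite ≥⇒<ᵇ-false (<⇒≤ N<y) | ≥⇒<ᵇ-false N<y | <⇒≡ᵇ-false N<y = refl

count-labels : ∀ N y → 0 < y → y ≤ N → sum (map (λ v → [ v ≡ᵇ y ]ᵇ) (labels N)) ≡ 1
count-labels N (suc y) _ y<N =
  trans (sum-map-∘ _ suc (upTo N)) (trans (count-≡ᵇ-upTo N y) (cong (λ b → if b then 1 else 0) (<⇒<ᵇ-true y<N)))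

sum-occ-labels : ∀ N L → All (λ y → 0 < y × y ≤ N) L → sum (map (λ v → occ v L) (labels N)) ≡ length L
sum-occ-labels N []      []                    = sum-map-0 (labels N)
sum-occ-labels N (y ∷ L) ((0<y , y≤N) ∷ inL) =
  trans (sum-map-+ (λ v → [ v ≡ᵇ y ]ᵇ) (λ v → occ v L) (labels N)) (cong₂ _+_ (count-labels N y 0<y y≤N) (sum-occ-labels N L inL))

elem⇒occ≥1 : ∀ v L → elem v L ≡ true → 1 ≤ occ v L
elem⇒occ≥1 v (y ∷ L) h with v ≡ᵇ y
... | true  = s≤s z≤n
... | false = elem⇒occ≥1 v L h

occ≥1⇒elem : ∀ v L → 1 ≤ occ v L → elem v L ≡ true
occ≥1⇒elem v (y ∷ L) h with v ≡ᵇ y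
... | true  = refl
... | false = occ≥1⇒elem v L h

length-labels : ∀ N → length (labels N) ≡ N
length-labels N = trans (length-map suc (upTo N)) (length-upTo N)

-- isBijLabeling only asks every label to occur; for a word of length N this forces each to occur once.
isBijLabeling≡bijectiveᵇ : ∀ N L → length L ≡ N → All (λ y → 0 < y × y ≤ N) L → isBijLabeling N L ≡ bijectiveᵇ N L
isBijLabeling≡bijectiveᵇ N L lL inL = bool-ext
  (λ h → all-true⁺ _ (labels N) (All.map (λ e → ≡⇒≡ᵇ-true e) (map⁻ (ones h))))
  (λ h → all-true⁺ _ (labels N)
           (All.map (λ {v} e → occ≥1⇒elem v L (≤-reflexive (sym (≡ᵇ-true⇒≡ _ _ e)))) (all-true⁻ _ (labels N) h)))
  where
  ones : isBijLabeling N L ≡ true → All (_≡ 1) (map (λ v → occ v L) (labels N))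
  ones h = sum≤length⇒≡1 _ (map⁺ (All.map (λ {v} e → elem⇒occ≥1 v L e) (all-true⁻ _ (labels N) h)))
    (≤-reflexive (trans (sum-occ-labels N L inL) (trans lL (trans (sym (length-labels N)) (sym (length-map _ (labels N)))))))

labels-inRange : ∀ N → All (λ y → 0 < y × y ≤ N) (labels N)
labels-inRange N = map⁺ (All.map (λ i<N → s≤s z≤n , i<N) (all-upTo N))

numLinExt≡linExt : ∀ N R → InRange N R → numLinExt (genPoset N R) ≡ linExt (relᵇ R) (upTo N)
numLinExt≡linExt N R inRange = begin
  length (filter (T? ∘ preserves R) (bijLabelings N))
    ≡⟨ length-filter (preserves R) (bijLabelings N) ⟩
  count (preserves R) (filter (T? ∘ isBijLabeling N) (words (labels N) N))
    ≡⟨ count-filter (preserves R) (isBijLabeling N) (words (labels N) N) ⟩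
  count (λ L → isBijLabeling N L ∧ preserves R L) (words (labels N) N)
    ≡⟨ count-cong _ (All-words (labels N) (labels-inRange N) N
                              (λ w lw inw → cong₂ _∧_ (isBijLabeling≡bijectiveᵇ N w lw inw) (preserves≡preservesᵇ N R w inRange))) ⟩
  countLinExt N (relᵇ R)
    ≡⟨ countLinExt≡linExt N (relᵇ R) ⟩
  linExt (relᵇ R) (upTo N) ∎
  where open ≡-Reasoning

data RelA (n : ℕ) : ℕ → ℕ → Set where
  r<ℓ : ∀ t → t < n → RelA n (3 * t) (suc (3 * t))
  r<q : ∀ t → t < n → RelA n (3 * t) (suc (suc (3 * t)))
  q<ℓ : ∀ t → suc t < n → RelA n (suc (suc (3 * t))) (suc (3 * suc t))

+1≡suc : ∀ k → k + 1 ≡ suc k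
+1≡suc k = +-comm k 1

+2≡suc² : ∀ k → k + 2 ≡ suc (suc k)
+2≡suc² k = +-comm k 2

shrubPairs linkPair : ℕ → ℕ → ℕ → Bool
shrubPairs x y t = ((3 * t ≡ᵇ x) ∧ (3 * t + 1 ≡ᵇ y)) ∨ (((3 * t ≡ᵇ x) ∧ (3 * t + 2 ≡ᵇ y)) ∨ false)
linkPair   x y t = (3 * t + 2 ≡ᵇ x) ∧ (3 * suc t + 1 ≡ᵇ y)

relᵇ-relsA : ∀ n x y → relᵇ (relsA n) x y ≡ any (shrubPairs x y) (upTo n) ∨ any (linkPair x y) (upTo (n ∸ 1))
relᵇ-relsA n x y = trans (any-++ P (concatMap shrub (idx n)) (map link (idx (n ∸ 1))))
  (cong₂ _∨_ (trans (any-concatMap P shrub (idx n)) (any-map (any P ∘ shrub) suc (upTo n)))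
             (trans (any-map P link (idx (n ∸ 1))) (any-map (P ∘ link) suc (upTo (n ∸ 1)))))
  where
  P : ℕ × ℕ → Bool
  P p = (proj₁ p ≡ᵇ x) ∧ (proj₂ p ≡ᵇ y)
  shrub : ℕ → List (ℕ × ℕ)
  shrub i = (r i , ℓ i) ∷ (r i , q i) ∷ []
  link : ℕ → ℕ × ℕ
  link i = q i , ℓ (suc i)

relsA-sound : ∀ n x y → relᵇ (relsA n) x y ≡ true → RelA n x y
relsA-sound n x y h with ∨-≡true⁻ {any (shrubPairs x y) (upTo n)} (trans (sym (relᵇ-relsA n x y)) h)
... | inj₁ h₁ with any-upTo⁻ (shrubPairs x y) n h₁
...   | t , t<n , e with ∨-≡true⁻ {(3 * t ≡ᵇ x) ∧ (3 * t + 1 ≡ᵇ y)} e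
...     | inj₁ e₁ = let ex , ey = ∧-≡true⁻ {3 * t ≡ᵇ x} e₁ in
          subst₂ (RelA n) (≡ᵇ-true⇒≡ _ _ ex) (trans (sym (+1≡suc _)) (≡ᵇ-true⇒≡ _ _ ey)) (r<ℓ t t<n)
...     | inj₂ e₂ with ∨-≡true⁻ {(3 * t ≡ᵇ x) ∧ (3 * t + 2 ≡ᵇ y)} e₂
...       | inj₁ e₃ = let ex , ey = ∧-≡true⁻ {3 * t ≡ᵇ x} e₃ in
            subst₂ (RelA n) (≡ᵇ-true⇒≡ _ _ ex) (trans (sym (+2≡suc² _)) (≡ᵇ-true⇒≡ _ _ ey)) (r<q t t<n)
relsA-sound (suc n) x y h | inj₂ h₂ with any-upTo⁻ (linkPair x y) n h₂
... | t , t<n , e = let ex , ey = ∧-≡true⁻ {3 * t + 2 ≡ᵇ x} e in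
  subst₂ (RelA (suc n)) (trans (sym (+2≡suc² _)) (≡ᵇ-true⇒≡ _ _ ex)) (trans (sym (+1≡suc _)) (≡ᵇ-true⇒≡ _ _ ey))
         (q<ℓ t (s≤s t<n))

relsA-complete : ∀ n x y → RelA n x y → relᵇ (relsA n) x y ≡ true
relsA-complete n x y rel = trans (relᵇ-relsA n x y) (pairs rel)
  where
  pairs : RelA n x y → (any (shrubPairs x y) (upTo n) ∨ any (linkPair x y) (upTo (n ∸ 1))) ≡ true
  pairs (r<ℓ t t<n) = ∨-≡trueˡ (any (linkPair x y) (upTo (n ∸ 1))) (any-upTo⁺ _ n t t<n
    (∨-≡trueˡ (((3 * t ≡ᵇ x) ∧ (3 * t + 2 ≡ᵇ y)) ∨ false)
              (cong₂ _∧_ (≡ᵇ-refl (3 * t)) (≡⇒≡ᵇ-true (+1≡suc (3 * t))))))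
  pairs (r<q t t<n) = ∨-≡trueˡ (any (linkPair x y) (upTo (n ∸ 1))) (any-upTo⁺ _ n t t<n
    (∨-≡trueʳ ((3 * t ≡ᵇ x) ∧ (3 * t + 1 ≡ᵇ y))
              (∨-≡trueˡ false (cong₂ _∧_ (≡ᵇ-refl (3 * t)) (≡⇒≡ᵇ-true (+2≡suc² (3 * t)))))))
  pairs (q<ℓ t (s≤s t<n)) = ∨-≡trueʳ (any (shrubPairs x y) (upTo n)) (any-upTo⁺ _ _ t t<n
    (cong₂ _∧_ (≡⇒≡ᵇ-true (+2≡suc² (3 * t))) (≡⇒≡ᵇ-true (+1≡suc (3 * suc t)))))

3t+2<3n : ∀ {t n} → t < n → suc (suc (3 * t)) < 3 * n
3t+2<3n {t} {n} t<n = subst (_≤ 3 * n) (3*-suc t) (*-monoʳ-≤ 3 t<n)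

RelA-inRange : ∀ {n x y} → RelA n x y → x < 3 * n × y < 3 * n
RelA-inRange (r<ℓ t t<n) = <-trans (<-trans (n<1+n _) (n<1+n _)) (3t+2<3n t<n) , <-trans (n<1+n _) (3t+2<3n t<n)
RelA-inRange (r<q t t<n) = <-trans (<-trans (n<1+n _) (n<1+n _)) (3t+2<3n t<n) , 3t+2<3n t<n
RelA-inRange (q<ℓ t t<n) = 3t+2<3n (<-trans (n<1+n t) t<n) , <-trans (n<1+n _) (3t+2<3n t<n)

relsA-inRange : ∀ n → InRange (3 * n) (relsA n)
relsA-inRange n = All.map (λ e → RelA-inRange (relsA-sound n _ _ e)) (relᵇ-self (relsA n))

-- Aₙ, Eₙ, Sₙ and Bₙ are zigzags

data Mod3 : ℕ → Set where
  3t   : ∀ t → Mod3 (3 * t)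
  3t+1 : ∀ t → Mod3 (suc (3 * t))
  3t+2 : ∀ t → Mod3 (suc (suc (3 * t)))

mod3 : ∀ a → Mod3 a
mod3 zero = 3t 0
mod3 (suc a) with mod3 a
... | 3t t   = 3t+1 t
... | 3t+1 t = 3t+2 t
... | 3t+2 t = subst Mod3 (3*-suc t) (3t (suc t))

-- Zigzag position 3t, 3t+1, 3t+2 holds ℓ, r, q of the (t+1)-st shrub, while Aₙ numbers them r, ℓ, q.
swapRℓ : ℕ → ℕ
swapRℓ zero                = 1
swapRℓ (suc zero)          = 0
swapRℓ (suc (suc zero))    = 2
swapRℓ (suc (suc (suc p))) = suc (suc (suc (swapRℓ p)))

swapRℓ-3t : ∀ t → swapRℓ (3 * t) ≡ suc (3 * t)
swapRℓ-3t zero    = refl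
swapRℓ-3t (suc t) = subst (λ k → swapRℓ k ≡ suc k) (sym (3*-suc t)) (cong (λ z → suc (suc (suc z))) (swapRℓ-3t t))

swapRℓ-3t+1 : ∀ t → swapRℓ (suc (3 * t)) ≡ 3 * t
swapRℓ-3t+1 zero    = refl
swapRℓ-3t+1 (suc t) = subst (λ k → swapRℓ (suc k) ≡ k) (sym (3*-suc t)) (cong (λ z → suc (suc (suc z))) (swapRℓ-3t+1 t))

swapRℓ-3t+2 : ∀ t → swapRℓ (suc (suc (3 * t))) ≡ suc (suc (3 * t))
swapRℓ-3t+2 zero    = refl
swapRℓ-3t+2 (suc t) = subst (λ k → swapRℓ (suc (suc k)) ≡ suc (suc k)) (sym (3*-suc t)) (cong (λ z → suc (suc (suc z))) (swapRℓ-3t+2 t))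

swapRℓ-involutive : ∀ a → swapRℓ (swapRℓ a) ≡ a
swapRℓ-involutive zero                = refl
swapRℓ-involutive (suc zero)          = refl
swapRℓ-involutive (suc (suc zero))    = refl
swapRℓ-involutive (suc (suc (suc p))) = cong (λ z → suc (suc (suc z))) (swapRℓ-involutive p)

swapRℓ-< : ∀ n a → a < 3 * n → swapRℓ a < 3 * n
swapRℓ-< n a a< with mod3 a
... | 3t t   = subst (_< 3 * n) (sym (swapRℓ-3t t)) (<-trans (n<1+n _) (3t+2<3n (*-cancelˡ-< 3 t n a<)))
... | 3t+1 t = subst (_< 3 * n) (sym (swapRℓ-3t+1 t)) (<-trans (n<1+n _) a<)
... | 3t+2 t = subst (_< 3 * n) (sym (swapRℓ-3t+2 t)) a<

swapRℓ-≢ : ∀ n p → p ≤ 3 * n → swapRℓ p ≢ 3 * n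
swapRℓ-≢ n p p≤ e = <-irrefl refl (subst (_≤ 3 * n) (trans (sym (swapRℓ-involutive p)) (trans (cong swapRℓ e) (swapRℓ-3t n))) p≤)

3t+1<3n⇒t<n : ∀ {t n} → suc (3 * t) < 3 * n → t < n
3t+1<3n⇒t<n {t} {n} h = *-cancelˡ-< 3 t n (<-trans (n<1+n _) h)

3t+2<3n⇒t<n : ∀ {t n} → suc (suc (3 * t)) < 3 * n → t < n
3t+2<3n⇒t<n h = 3t+1<3n⇒t<n (<-trans (n<1+n _) h)

zigzag-up : ∀ w a b → suc a ≡ b → w a ≡ true → zigzag w a b ≡ true
zigzag-up w a b refl e = ∨-≡trueˡ ((suc b ≡ᵇ a) ∧ not (w b)) (cong₂ _∧_ (≡ᵇ-refl (suc a)) e)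

zigzag-down : ∀ w a b → suc b ≡ a → w b ≡ false → zigzag w a b ≡ true
zigzag-down w a b refl e = ∨-≡trueʳ ((suc a ≡ᵇ b) ∧ w a) (cong₂ _∧_ (≡ᵇ-refl (suc b)) (cong not e))

zigzag⁻ : ∀ w a b → zigzag w a b ≡ true → (b ≡ suc a × w a ≡ true) ⊎ (a ≡ suc b × w b ≡ false)
zigzag⁻ w a b h with ∨-≡true⁻ {(suc a ≡ᵇ b) ∧ w a} h
... | inj₁ e = let e₁ , e₂ = ∧-≡true⁻ {suc a ≡ᵇ b} e in inj₁ (sym (≡ᵇ-true⇒≡ _ _ e₁) , e₂)
... | inj₂ e = let e₁ , e₂ = ∧-≡true⁻ {suc b ≡ᵇ a} e in inj₂ (sym (≡ᵇ-true⇒≡ _ _ e₁) , not-≡true⁻ e₂)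

zigzagA⇒RelA : ∀ n a b → a < 3 * n → b < 3 * n → zigzag stepsA a b ≡ true → RelA n (swapRℓ a) (swapRℓ b)
zigzagA⇒RelA n a b a< b< h with zigzag⁻ stepsA a b h
zigzagA⇒RelA n a b a< b< h | inj₁ (refl , up) with mod3 a
... | 3t t   = true≢false up (stepsS-3t+1 t)
... | 3t+1 t = subst₂ (RelA n) (sym (swapRℓ-3t+1 t)) (sym (swapRℓ-3t+2 t)) (r<q t (3t+2<3n⇒t<n b<))
... | 3t+2 t = subst₂ (RelA n) (sym (swapRℓ-3t+2 t)) (sym (trans (cong (λ z → suc (suc (suc z))) (swapRℓ-3t t)) (cong suc (sym (3*-suc t)))))
                      (q<ℓ t (*-cancelˡ-< 3 (suc t) n (subst (_< 3 * n) (sym (3*-suc t)) b<)))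
zigzagA⇒RelA n a b a< b< h | inj₂ (refl , down) with mod3 b
... | 3t t   = subst₂ (RelA n) (sym (swapRℓ-3t+1 t)) (sym (swapRℓ-3t t)) (r<ℓ t (3t+1<3n⇒t<n a<))
... | 3t+1 t = true≢false (stepsS-3t+2 t) down
... | 3t+2 t = true≢false (stepsS-3t t) down

RelA⇒zigzagA : ∀ {n x y} → RelA n x y → zigzag stepsA (swapRℓ x) (swapRℓ y) ≡ true
RelA⇒zigzagA (r<ℓ t _) rewrite swapRℓ-3t t | swapRℓ-3t+1 t = zigzag-down stepsA (suc (3 * t)) (3 * t) refl (stepsS-3t+1 t)
RelA⇒zigzagA (r<q t _) rewrite swapRℓ-3t t | swapRℓ-3t+2 t = zigzag-up stepsA (suc (3 * t)) (suc (suc (3 * t))) refl (stepsS-3t+2 t)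
RelA⇒zigzagA (q<ℓ t _) rewrite swapRℓ-3t+2 t =
  subst (λ z → zigzag stepsA (suc (suc (3 * t))) z ≡ true) (sym (trans (swapRℓ-3t+1 (suc t)) (3*-suc t)))
        (zigzag-up stepsA (suc (suc (3 * t))) (suc (suc (suc (3 * t)))) refl (stepsS-3t t))

numLinExt≡zigzagExt : ∀ N R (w : ℕ → Bool) (π : ℕ → ℕ) → InRange N R →
  (∀ a b → a < N → b < N → relᵇ R (π a) (π b) ≡ zigzag w a b) → map π (upTo N) ↭ upTo N →
  numLinExt (genPoset N R) ≡ zigzagExt w N
numLinExt≡zigzagExt N R w π inRange related perm = begin
  numLinExt (genPoset N R)         ≡⟨ numLinExt≡linExt N R inRange ⟩
  linExt (relᵇ R) (upTo N)          ≡⟨ linExt-↭ (relᵇ R) perm ⟨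
  linExt (relᵇ R) (map π (upTo N))  ≡⟨ linExt-map (relᵇ R) π (upTo N) ⟩
  linExt (relᵇ R on π) (upTo N)     ≡⟨ linExtN-cong (_< N) (length (upTo N)) _ _ (upTo N) (all-upTo N) related ⟩
  zigzagExt w N                     ∎
  where open ≡-Reasoning

upTo-3*-suc : ∀ n → upTo (3 * suc n) ≡ upTo (3 * n) ++ (3 * n ∷ suc (3 * n) ∷ suc (suc (3 * n)) ∷ [])
upTo-3*-suc n = begin
  upTo (3 * suc n)                                           ≡⟨ cong upTo (3*-suc n) ⟩
  upTo (suc (suc (suc k)))                                   ≡⟨ upTo-∷ʳ (suc (suc k)) ⟨
  upTo (suc (suc k)) ∷ʳ suc (suc k)                          ≡⟨ cong (_∷ʳ suc (suc k)) (upTo-∷ʳ (suc k)) ⟨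
  (upTo (suc k) ∷ʳ suc k) ∷ʳ suc (suc k)                     ≡⟨ cong (λ l → (l ∷ʳ suc k) ∷ʳ suc (suc k)) (upTo-∷ʳ k) ⟨
  ((upTo k ∷ʳ k) ∷ʳ suc k) ∷ʳ suc (suc k)                    ≡⟨ ++-assoc (upTo k ∷ʳ k) _ _ ⟩
  (upTo k ∷ʳ k) ++ (suc k ∷ suc (suc k) ∷ [])                ≡⟨ ++-assoc (upTo k) _ _ ⟩
  upTo k ++ (k ∷ suc k ∷ suc (suc k) ∷ [])                   ∎
  where
  open ≡-Reasoning
  k = 3 * n

map-swapRℓ-↭ : ∀ n → map swapRℓ (upTo (3 * n)) ↭ upTo (3 * n)
map-swapRℓ-↭ zero    = ↭.refl
map-swapRℓ-↭ (suc n) = ↭.trans (↭.↭-reflexive swapped)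
  (↭.trans (↭.++⁺ (map-swapRℓ-↭ n) (↭.swap _ _ ↭.refl)) (↭.↭-reflexive (sym (upTo-3*-suc n))))
  where
  swapped : map swapRℓ (upTo (3 * suc n)) ≡ map swapRℓ (upTo (3 * n)) ++ (suc (3 * n) ∷ 3 * n ∷ suc (suc (3 * n)) ∷ [])
  swapped = trans (cong (map swapRℓ) (upTo-3*-suc n)) (trans (map-++ swapRℓ (upTo (3 * n)) _)
              (cong (map swapRℓ (upTo (3 * n)) ++_)
                    (cong₂ _∷_ (swapRℓ-3t n) (cong₂ _∷_ (swapRℓ-3t+1 n) (cong₂ _∷_ (swapRℓ-3t+2 n) refl)))))

relsA-zigzag : ∀ n a b → a < 3 * n → b < 3 * n → relᵇ (relsA n) (swapRℓ a) (swapRℓ b) ≡ zigzag stepsA a b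
relsA-zigzag n a b a< b< = bool-ext
  (λ h → subst₂ (λ a′ b′ → zigzag stepsA a′ b′ ≡ true) (swapRℓ-involutive a) (swapRℓ-involutive b)
                (RelA⇒zigzagA (relsA-sound n _ _ h)))
  (λ h → relsA-complete n _ _ (zigzagA⇒RelA n a b a< b< h))

LA≡zigzagExt : ∀ n → LA n ≡ zigzagExt stepsA (3 * n)
LA≡zigzagExt zero      = refl
LA≡zigzagExt n@(suc _) = numLinExt≡zigzagExt (3 * n) (relsA n) stepsA swapRℓ (relsA-inRange n) (relsA-zigzag n) (map-swapRℓ-↭ n)

zigzagA⇒RelA-or-last : ∀ n′ p p′ → p < suc (3 * suc n′) → p′ < suc (3 * suc n′) → zigzag stepsA p p′ ≡ true →
  (p < 3 * suc n′ × p′ < 3 * suc n′ × RelA (suc n′) (swapRℓ p) (swapRℓ p′)) ⊎ (p ≡ suc (suc (3 * n′)) × p′ ≡ 3 * suc n′)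
zigzagA⇒RelA-or-last n′ p p′ p< p′< h with <-cmp p (3 * suc n′) | <-cmp p′ (3 * suc n′)
... | _             | tri> _ _ c = ⊥-elim (<-irrefl refl (<-≤-trans c (≤-pred p′<)))
... | tri> _ _ c    | _          = ⊥-elim (<-irrefl refl (<-≤-trans c (≤-pred p<)))
... | tri< a _ _    | tri< b _ _ = inj₁ (a , b , zigzagA⇒RelA (suc n′) p p′ a b h)
... | tri< a _ _    | tri≈ _ refl _ with zigzag⁻ stepsA p p′ h
...   | inj₁ (e , _) = inj₂ (suc-injective (trans (sym e) (3*-suc n′)) , refl)
...   | inj₂ (e , _) = ⊥-elim (<-irrefl e p<)
zigzagA⇒RelA-or-last n′ p p′ p< p′< h | tri≈ _ refl _ | tri< b _ _ with zigzag⁻ stepsA p p′ h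
...   | inj₁ (e , _)    = ⊥-elim (<-irrefl refl (<-trans (subst (_< 3 * suc n′) e b) (n<1+n _)))
...   | inj₂ (e , down) = true≢false (trans (cong stepsS (sym e)) (stepsS-3t (suc n′))) down
zigzagA⇒RelA-or-last n′ p p′ p< p′< h | tri≈ _ refl _ | tri≈ _ e′ _ with zigzag⁻ stepsA p p′ h
...   | inj₁ (e , _) = ⊥-elim (<-irrefl (trans (sym e′) e) (n<1+n _))
...   | inj₂ (e , _) = ⊥-elim (<-irrefl (trans e′ e) (n<1+n _))

q-suc : ∀ n′ → q (suc n′) ≡ suc (suc (3 * n′))
q-suc n′ = +2≡suc² (3 * n′)

qₙ<3n : ∀ n′ → q (suc n′) < 3 * suc n′
qₙ<3n n′ = subst (_< 3 * suc n′) (sym (q-suc n′)) (3t+2<3n ≤-refl)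

<⇒<+1 : ∀ {a k} → a < k → a < k + 1
<⇒<+1 {a} {k} p = subst (a <_) (sym (+1≡suc k)) (<-trans p (n<1+n k))

<⇒<+2 : ∀ {a k} → a < k → a < k + 2
<⇒<+2 {a} {k} p = subst (a <_) (sym (+2≡suc² k)) (<-trans p (<-trans (n<1+n k) (n<1+n _)))

relsA-inRange+ : ∀ n k → InRange (3 * n + k) (relsA n)
relsA-inRange+ n k = All.map (λ { (a , b) → <-≤-trans a (m≤m+n _ k) , <-≤-trans b (m≤m+n _ k) }) (relsA-inRange n)

-- Eₙ: positions 0, …, 3n-1 as for Aₙ, then e.

toE : ℕ → ℕ → ℕ
toE n a = if a <ᵇ 3 * n then swapRℓ a else a

toE-< : ∀ n a → a < 3 * n → toE n a ≡ swapRℓ a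
toE-< n a a< = cong (λ b → if b then swapRℓ a else a) (<⇒<ᵇ-true a<)

toE-3n : ∀ n → toE n (3 * n) ≡ 3 * n
toE-3n n = cong (λ b → if b then swapRℓ (3 * n) else 3 * n) (≥⇒<ᵇ-false (≤-refl {3 * n}))

toE-involutive : ∀ n a → a < suc (3 * n) → toE n (toE n a) ≡ a
toE-involutive n a a< with <-cmp a (3 * n)
... | tri< l _ _    = trans (cong (toE n) (toE-< n a l)) (trans (toE-< n (swapRℓ a) (swapRℓ-< n a l)) (swapRℓ-involutive a))
... | tri≈ _ refl _ = trans (cong (toE n) (toE-3n n)) (toE-3n n)
... | tri> _ _ c    = ⊥-elim (<-irrefl refl (<-≤-trans c (≤-pred a<)))

relsE : ℕ → List (ℕ × ℕ)
relsE n = relsA n ++ (q n , 3 * n) ∷ []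

relsE⇒zigzag : ∀ n′ x y → relᵇ (relsE (suc n′)) x y ≡ true → zigzag stepsA (toE (suc n′) x) (toE (suc n′) y) ≡ true
relsE⇒zigzag n′ x y h with ∨-≡true⁻ {relᵇ (relsA (suc n′)) x y} (trans (sym (relᵇ-++ (relsA (suc n′)) _ x y)) h)
... | inj₁ h₁ with relsA-sound (suc n′) x y h₁
...   | rel rewrite toE-< (suc n′) x (proj₁ (RelA-inRange rel)) | toE-< (suc n′) y (proj₂ (RelA-inRange rel)) = RelA⇒zigzagA rel
relsE⇒zigzag n′ x y h | inj₂ h₂ with relᵇ-∷⁻ (q (suc n′)) (3 * suc n′) [] x y h₂
... | inj₁ (refl , refl) rewrite toE-3n (suc n′) | toE-< (suc n′) (q (suc n′)) (qₙ<3n n′) | q-suc n′ | swapRℓ-3t+2 n′ =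
  zigzag-up stepsA (suc (suc (3 * n′))) (3 * suc n′) (sym (3*-suc n′)) (stepsS-3t n′)

zigzag⇒relsE : ∀ n′ a b → a < suc (3 * suc n′) → b < suc (3 * suc n′) → zigzag stepsA a b ≡ true →
               relᵇ (relsE (suc n′)) (toE (suc n′) a) (toE (suc n′) b) ≡ true
zigzag⇒relsE n′ a b a< b< h with zigzagA⇒RelA-or-last n′ a b a< b< h
... | inj₁ (a<3n , b<3n , rel) rewrite toE-< (suc n′) a a<3n | toE-< (suc n′) b b<3n =
  trans (relᵇ-++ (relsA (suc n′)) _ (swapRℓ a) (swapRℓ b))
        (∨-≡trueˡ (relᵇ ((q (suc n′) , 3 * suc n′) ∷ []) (swapRℓ a) (swapRℓ b)) (relsA-complete (suc n′) _ _ rel))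
... | inj₂ (refl , refl) rewrite toE-3n (suc n′) | toE-< (suc n′) (suc (suc (3 * n′))) (3t+2<3n ≤-refl) | swapRℓ-3t+2 n′ =
  trans (relᵇ-++ (relsA (suc n′)) E X (3 * suc n′))
        (∨-≡trueʳ (relᵇ (relsA (suc n′)) X (3 * suc n′))
                  (subst (λ z → relᵇ ((z , 3 * suc n′) ∷ []) X (3 * suc n′) ≡ true) (sym (q-suc n′)) (relᵇ-here X (3 * suc n′) [])))
  where
  E = (q (suc n′) , 3 * suc n′) ∷ []
  X = suc (suc (3 * n′))

relsE-zigzag : ∀ n′ a b → a < 3 * suc n′ + 1 → b < 3 * suc n′ + 1 →
               relᵇ (relsE (suc n′)) (toE (suc n′) a) (toE (suc n′) b) ≡ zigzag stepsA a b
relsE-zigzag n′ a b a< b< = bool-ext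
  (λ h → subst₂ (λ a′ b′ → zigzag stepsA a′ b′ ≡ true) (toE-involutive (suc n′) a a<′) (toE-involutive (suc n′) b b<′)
                (relsE⇒zigzag n′ (toE (suc n′) a) (toE (suc n′) b) h))
  (zigzag⇒relsE n′ a b a<′ b<′)
  where
  a<′ = subst (a <_) (+1≡suc _) a<
  b<′ = subst (b <_) (+1≡suc _) b<

relsE-inRange : ∀ n′ → InRange (3 * suc n′ + 1) (relsE (suc n′))
relsE-inRange n′ = ++⁺ (relsA-inRange+ (suc n′) 1) ((<⇒<+1 (qₙ<3n n′) , subst (3 * suc n′ <_) (sym (+1≡suc _)) (n<1+n _)) ∷ [])

map-toE-↭ : ∀ n → map (toE n) (upTo (3 * n + 1)) ↭ upTo (3 * n + 1)
map-toE-↭ n = ↭.trans (↭.↭-reflexive split)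
  (↭.trans (++⁺ʳ _ (map-swapRℓ-↭ n)) (↭.↭-reflexive (trans (upTo-∷ʳ (3 * n)) (cong upTo (sym (+1≡suc _))))))
  where
  split : map (toE n) (upTo (3 * n + 1)) ≡ map swapRℓ (upTo (3 * n)) ++ (3 * n ∷ [])
  split = trans (cong (map (toE n) ∘ upTo) (+1≡suc _)) (trans (cong (map (toE n)) (sym (upTo-∷ʳ (3 * n))))
            (trans (map-++ (toE n) (upTo (3 * n)) _)
                   (cong₂ _++_ (map-cong-local (All.map (toE-< n _) (all-upTo (3 * n)))) (cong (_∷ []) (toE-3n n)))))

LE≡zigzagExt : ∀ n → LE n ≡ zigzagExt stepsA (suc (3 * n))
LE≡zigzagExt zero       = refl
LE≡zigzagExt n@(suc n′) =
  trans (numLinExt≡zigzagExt (3 * n + 1) (relsE n) stepsA (toE n) (relsE-inRange n′) (relsE-zigzag n′) (map-toE-↭ n))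
        (cong (zigzagExt stepsA) (+1≡suc (3 * n)))

-- Sₙ and Bₙ: s at position 0, then the positions of Aₙ (and of e) shifted by one.

toS : ℕ → ℕ → ℕ
toS n zero    = 3 * n
toS n (suc p) = swapRℓ p

fromS : ℕ → ℕ → ℕ
fromS n x = if x ≡ᵇ 3 * n then 0 else suc (swapRℓ x)

fromS-≢ : ∀ n x → x ≢ 3 * n → fromS n x ≡ suc (swapRℓ x)
fromS-≢ n x ne = cong (λ b → if b then 0 else suc (swapRℓ x)) (≢⇒≡ᵇ-false x (3 * n) ne)

fromS-toS : ∀ n a → a < suc (suc (3 * n)) → fromS n (toS n a) ≡ a
fromS-toS n zero    _        = cong (λ b → if b then 0 else suc (swapRℓ (3 * n))) (≡ᵇ-refl (3 * n))
fromS-toS n (suc p) (s≤s p<) = trans (fromS-≢ n (swapRℓ p) (swapRℓ-≢ n p (≤-pred p<))) (cong suc (swapRℓ-involutive p))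

relsS relsB : ℕ → List (ℕ × ℕ)
relsS n = relsA n ++ (3 * n , ℓ 1) ∷ []
relsB n = relsA n ++ (3 * n , ℓ 1) ∷ (q n , 3 * n + 1) ∷ []

1≢3*suc : ∀ n′ → 1 ≢ 3 * suc n′
1≢3*suc n′ e with trans e (3*-suc n′)
... | ()

RelA⇒zigzagS : ∀ n x y → RelA n x y → zigzag stepsS (fromS n x) (fromS n y) ≡ true
RelA⇒zigzagS n x y rel rewrite fromS-≢ n x (<⇒≢ (proj₁ (RelA-inRange rel))) | fromS-≢ n y (<⇒≢ (proj₂ (RelA-inRange rel))) =
  RelA⇒zigzagA rel

s<ℓ₁-zigzag : ∀ n′ → zigzag stepsS (fromS (suc n′) (3 * suc n′)) (fromS (suc n′) 1) ≡ true
s<ℓ₁-zigzag n′ rewrite fromS-≢ (suc n′) 1 (1≢3*suc n′) | ≡ᵇ-refl (3 * suc n′) = refl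

qₙ<e-zigzag : ∀ n′ → zigzag stepsS (fromS (suc n′) (q (suc n′))) (fromS (suc n′) (3 * suc n′ + 1)) ≡ true
qₙ<e-zigzag n′ rewrite fromS-≢ (suc n′) (q (suc n′)) (<⇒≢ (qₙ<3n n′))
                     | fromS-≢ (suc n′) (3 * suc n′ + 1) (>⇒≢ (m<m+n (3 * suc n′) (s≤s z≤n)))
                     | q-suc n′ | swapRℓ-3t+2 n′ | +1≡suc (3 * suc n′) | swapRℓ-3t+1 (suc n′) =
  zigzag-up stepsS (suc (suc (suc (3 * n′)))) (suc (3 * suc n′)) (cong suc (sym (3*-suc n′))) (stepsS-3t n′)

relsS⇒zigzag : ∀ n′ x y → relᵇ (relsS (suc n′)) x y ≡ true → zigzag stepsS (fromS (suc n′) x) (fromS (suc n′) y) ≡ true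
relsS⇒zigzag n′ x y h with ∨-≡true⁻ {relᵇ (relsA (suc n′)) x y} (trans (sym (relᵇ-++ (relsA (suc n′)) _ x y)) h)
... | inj₁ h₁ = RelA⇒zigzagS (suc n′) x y (relsA-sound (suc n′) x y h₁)
... | inj₂ h₂ with relᵇ-∷⁻ (3 * suc n′) 1 [] x y h₂
...   | inj₁ (refl , refl) = s<ℓ₁-zigzag n′

relsB⇒zigzag : ∀ n′ x y → relᵇ (relsB (suc n′)) x y ≡ true → zigzag stepsS (fromS (suc n′) x) (fromS (suc n′) y) ≡ true
relsB⇒zigzag n′ x y h with ∨-≡true⁻ {relᵇ (relsA (suc n′)) x y} (trans (sym (relᵇ-++ (relsA (suc n′)) _ x y)) h)
... | inj₁ h₁ = RelA⇒zigzagS (suc n′) x y (relsA-sound (suc n′) x y h₁)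
... | inj₂ h₂ with relᵇ-∷⁻ (3 * suc n′) 1 ((q (suc n′) , 3 * suc n′ + 1) ∷ []) x y h₂
...   | inj₁ (refl , refl) = s<ℓ₁-zigzag n′
...   | inj₂ h₃ with relᵇ-∷⁻ (q (suc n′)) (3 * suc n′ + 1) [] x y h₃
...     | inj₁ (refl , refl) = qₙ<e-zigzag n′

zigzag-from-s : ∀ w b → zigzag w 0 b ≡ true → b ≡ 1
zigzag-from-s w b h with zigzag⁻ w 0 b h
... | inj₁ (b≡1 , _) = b≡1
... | inj₂ (() , _)

zigzagS-to-s : ∀ a → zigzag stepsS a 0 ≡ true → ⊥
zigzagS-to-s a h with zigzag⁻ stepsS a 0 h
... | inj₁ (() , _)
... | inj₂ (refl , ())

module ExtendedByS (n′ : ℕ) (E : List (ℕ × ℕ)) (s<ℓ₁ : relᵇ E (3 * suc n′) 1 ≡ true) where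

  n = suc n′

  s-edge : ∀ {b} → b ≡ 1 → relᵇ (relsA n ++ E) (toS n 0) (toS n b) ≡ true
  s-edge refl = trans (relᵇ-++ (relsA n) E (3 * n) 1) (∨-≡trueʳ (relᵇ (relsA n) (3 * n) 1) s<ℓ₁)

  A-edge : ∀ {a b} → RelA n (swapRℓ a) (swapRℓ b) → relᵇ (relsA n ++ E) (toS n (suc a)) (toS n (suc b)) ≡ true
  A-edge {a} {b} rel = trans (relᵇ-++ (relsA n) E (swapRℓ a) (swapRℓ b))
                             (∨-≡trueˡ (relᵇ E (swapRℓ a) (swapRℓ b)) (relsA-complete n _ _ rel))

relsS-zigzag : ∀ n′ a b → a < 3 * suc n′ + 1 → b < 3 * suc n′ + 1 →
               relᵇ (relsS (suc n′)) (toS (suc n′) a) (toS (suc n′) b) ≡ zigzag stepsS a b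
relsS-zigzag n′ a b a< b< = bool-ext
  (λ h → subst₂ (λ a′ b′ → zigzag stepsS a′ b′ ≡ true)
                (fromS-toS (suc n′) a (<-trans a<′ (n<1+n _))) (fromS-toS (suc n′) b (<-trans b<′ (n<1+n _)))
                (relsS⇒zigzag n′ (toS (suc n′) a) (toS (suc n′) b) h))
  (zigzag⇒ a b a<′ b<′)
  where
  open ExtendedByS n′ ((3 * suc n′ , 1) ∷ []) (relᵇ-here (3 * suc n′) 1 [])
  a<′ = subst (a <_) (+1≡suc _) a<
  b<′ = subst (b <_) (+1≡suc _) b<
  zigzag⇒ : ∀ a b → a < suc (3 * n) → b < suc (3 * n) → zigzag stepsS a b ≡ true → relᵇ (relsS n) (toS n a) (toS n b) ≡ true
  zigzag⇒ zero    b       _        _        h = s-edge (zigzag-from-s stepsS b h)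
  zigzag⇒ (suc a) zero    _        _        h = ⊥-elim (zigzagS-to-s (suc a) h)
  zigzag⇒ (suc a) (suc b) (s≤s a<) (s≤s b<) h = A-edge (zigzagA⇒RelA n a b a< b< h)

relsB-zigzag : ∀ n′ a b → a < 3 * suc n′ + 2 → b < 3 * suc n′ + 2 →
               relᵇ (relsB (suc n′)) (toS (suc n′) a) (toS (suc n′) b) ≡ zigzag stepsS a b
relsB-zigzag n′ a b a< b< = bool-ext
  (λ h → subst₂ (λ a′ b′ → zigzag stepsS a′ b′ ≡ true) (fromS-toS (suc n′) a a<′) (fromS-toS (suc n′) b b<′)
                (relsB⇒zigzag n′ (toS (suc n′) a) (toS (suc n′) b) h))
  (zigzag⇒ a b a<′ b<′)
  where
  E = (3 * suc n′ , 1) ∷ (q (suc n′) , 3 * suc n′ + 1) ∷ []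
  open ExtendedByS n′ E (relᵇ-here (3 * suc n′) 1 ((q (suc n′) , 3 * suc n′ + 1) ∷ []))
  a<′ = subst (a <_) (+2≡suc² _) a<
  b<′ = subst (b <_) (+2≡suc² _) b<
  qₙ<e : relᵇ (relsB n) (suc (suc (3 * n′))) (suc (3 * n)) ≡ true
  qₙ<e = trans (relᵇ-++ (relsA n) E X (suc (3 * n))) (∨-≡trueʳ (relᵇ (relsA n) X (suc (3 * n)))
           (relᵇ-there (3 * n) 1 ((q n , 3 * n + 1) ∷ []) X (suc (3 * n))
                       (subst₂ (λ z z′ → relᵇ ((z , z′) ∷ []) X (suc (3 * n)) ≡ true)
                                                          (sym (q-suc n′)) (sym (+1≡suc (3 * n))) (relᵇ-here X (suc (3 * n)) []))))
    where X = suc (suc (3 * n′))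
  zigzag⇒ : ∀ a b → a < suc (suc (3 * n)) → b < suc (suc (3 * n)) → zigzag stepsS a b ≡ true →
            relᵇ (relsB n) (toS n a) (toS n b) ≡ true
  zigzag⇒ zero    b       _        _        h = s-edge (zigzag-from-s stepsS b h)
  zigzag⇒ (suc a) zero    _        _        h = ⊥-elim (zigzagS-to-s (suc a) h)
  zigzag⇒ (suc a) (suc b) (s≤s a<) (s≤s b<) h with zigzagA⇒RelA-or-last n′ a b a< b< h
  ... | inj₁ (_ , _ , rel)  = A-edge rel
  ... | inj₂ (refl , refl) rewrite swapRℓ-3t+2 n′ | swapRℓ-3t n = qₙ<e

s<ℓ₁-inRange : ∀ n′ k → 3 * suc n′ < 3 * suc n′ + suc k × 1 < 3 * suc n′ + suc k
s<ℓ₁-inRange n′ k =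
  m<m+n (3 * suc n′) (s≤s z≤n) , <-≤-trans (subst (1 <_) (sym (3*-suc n′)) (s≤s (s≤s z≤n))) (m≤m+n (3 * suc n′) (suc k))

relsS-inRange : ∀ n′ → InRange (3 * suc n′ + 1) (relsS (suc n′))
relsS-inRange n′ = ++⁺ (relsA-inRange+ (suc n′) 1) (s<ℓ₁-inRange n′ 0 ∷ [])

relsB-inRange : ∀ n′ → InRange (3 * suc n′ + 2) (relsB (suc n′))
relsB-inRange n′ = ++⁺ (relsA-inRange+ (suc n′) 2)
  (s<ℓ₁-inRange n′ 1 ∷
   (<⇒<+2 (qₙ<3n n′) , subst₂ _<_ (sym (+1≡suc (3 * suc n′))) (sym (+2≡suc² (3 * suc n′))) (n<1+n _)) ∷ [])

map-toS-↭ : ∀ n → map (toS n) (upTo (3 * n + 1)) ↭ upTo (3 * n + 1)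
map-toS-↭ n = ↭.trans (↭.↭-reflexive split) (↭.trans (∷↭∷ʳ (3 * n) (map swapRℓ (upTo (3 * n))))
   (↭.trans (++⁺ʳ _ (map-swapRℓ-↭ n)) (↭.↭-reflexive (trans (upTo-∷ʳ (3 * n)) (cong upTo (sym (+1≡suc _)))))))
  where
  split : map (toS n) (upTo (3 * n + 1)) ≡ 3 * n ∷ map swapRℓ (upTo (3 * n))
  split = trans (cong (map (toS n) ∘ upTo) (+1≡suc _))
                (trans (cong (map (toS n)) (upTo-suc (3 * n))) (cong (3 * n ∷_) (sym (map-∘ (upTo (3 * n))))))

map-toS-↭-B : ∀ n → map (toS n) (upTo (3 * n + 2)) ↭ upTo (3 * n + 2)
map-toS-↭-B n = ↭.trans (↭.↭-reflexive split) (↭.trans (↭.↭-sym (shift (3 * n) (map swapRℓ (upTo (3 * n))) (suc (3 * n) ∷ [])))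
   (↭.trans (++⁺ʳ _ (map-swapRℓ-↭ n)) (↭.↭-reflexive joined)))
  where
  split : map (toS n) (upTo (3 * n + 2)) ≡ 3 * n ∷ (map swapRℓ (upTo (3 * n)) ++ (suc (3 * n) ∷ []))
  split = begin
    map (toS n) (upTo (3 * n + 2))                          ≡⟨ cong (map (toS n) ∘ upTo) (+2≡suc² _) ⟩
    map (toS n) (upTo (suc (suc (3 * n))))                  ≡⟨ cong (map (toS n)) (upTo-suc (suc (3 * n))) ⟩
    3 * n ∷ map (toS n) (map suc (upTo (suc (3 * n))))      ≡⟨ cong (3 * n ∷_) (map-∘ (upTo (suc (3 * n)))) ⟨
    3 * n ∷ map swapRℓ (upTo (suc (3 * n)))                 ≡⟨ cong (λ l → 3 * n ∷ map swapRℓ l) (upTo-∷ʳ (3 * n)) ⟨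
    3 * n ∷ map swapRℓ (upTo (3 * n) ++ 3 * n ∷ [])         ≡⟨ cong (3 * n ∷_) (map-++ swapRℓ (upTo (3 * n)) _) ⟩
    3 * n ∷ (map swapRℓ (upTo (3 * n)) ++ swapRℓ (3 * n) ∷ []) ≡⟨ cong (λ z → 3 * n ∷ (map swapRℓ (upTo (3 * n)) ++ z ∷ [])) (swapRℓ-3t n) ⟩
    3 * n ∷ (map swapRℓ (upTo (3 * n)) ++ suc (3 * n) ∷ [])  ∎
    where open ≡-Reasoning
  joined : upTo (3 * n) ++ (3 * n ∷ []) ++ (suc (3 * n) ∷ []) ≡ upTo (3 * n + 2)
  joined = trans (sym (++-assoc (upTo (3 * n)) _ _)) (trans (cong (_∷ʳ suc (3 * n)) (upTo-∷ʳ (3 * n)))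
             (trans (upTo-∷ʳ (suc (3 * n))) (cong upTo (sym (+2≡suc² _)))))

LS≡zigzagExt : ∀ n → LS n ≡ zigzagExt stepsS (suc (3 * n))
LS≡zigzagExt zero       = refl
LS≡zigzagExt n@(suc n′) =
  trans (numLinExt≡zigzagExt (3 * n + 1) (relsS n) stepsS (toS n) (relsS-inRange n′) (relsS-zigzag n′) (map-toS-↭ n))
        (cong (zigzagExt stepsS) (+1≡suc (3 * n)))

LB≡zigzagExt : ∀ n → LB n ≡ zigzagExt stepsS (suc (suc (3 * n)))
LB≡zigzagExt zero       = refl
LB≡zigzagExt n@(suc n′) =
  trans (numLinExt≡zigzagExt (3 * n + 2) (relsB n) stepsS (toS n) (relsB-inRange n′) (relsB-zigzag n′) (map-toS-↭-B n))
        (cong (zigzagExt stepsS) (+2≡suc² (3 * n)))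

-- Increasing forests of shrubs are the linear extensions of Aₙ

OrderPreservingA : ℕ → List ℕ → Set
OrderPreservingA n L = ∀ x y → RelA n x y → nth L x < nth L y

preserves-relsA⇔ : ∀ n L → preserves (relsA n) L ≡ true ⇔ OrderPreservingA n L
preserves-relsA⇔ n L = mk⇔
  (λ h x y rel → preserves-sound (relsA n) L x y h (relsA-complete n x y rel))
  (λ P → preserves-complete (relsA n) L (All.map (λ e → P _ _ (relsA-sound n _ _ e)) (relᵇ-self (relsA n))))

RelA-suc : ∀ {n x y} → RelA n x y → RelA (suc n) (3 + x) (3 + y)
RelA-suc {n} (r<ℓ t t<n) = subst₂ (RelA (suc n)) (3*-suc t) (cong suc (3*-suc t)) (r<ℓ (suc t) (s≤s t<n))
RelA-suc {n} (r<q t t<n) = subst₂ (RelA (suc n)) (3*-suc t) (cong (suc ∘ suc) (3*-suc t)) (r<q (suc t) (s≤s t<n))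
RelA-suc {n} (q<ℓ t t<n) = subst₂ (RelA (suc n)) (cong (suc ∘ suc) (3*-suc t)) (cong suc (3*-suc (suc t))) (q<ℓ (suc t) (s≤s t<n))

OrderPreservingA-∷⁻ : ∀ m a b c L → OrderPreservingA (suc m) (a ∷ b ∷ c ∷ L) →
                      a < b × a < c × (1 ≤ m → c < nth L 1) × OrderPreservingA m L
OrderPreservingA-∷⁻ m a b c L P =
  P 0 1 (r<ℓ 0 (s≤s z≤n)) , P 0 2 (r<q 0 (s≤s z≤n)) , (λ 1≤m → P 2 4 (q<ℓ 0 (s≤s 1≤m))) ,
  (λ x y r → P (3 + x) (3 + y) (RelA-suc r))

OrderPreservingA-∷ : ∀ m a b c L → a < b → a < c → (1 ≤ m → c < nth L 1) → OrderPreservingA m L →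
                     OrderPreservingA (suc m) (a ∷ b ∷ c ∷ L)
OrderPreservingA-∷ m a b c L a<b a<c link P = shifted
  where
  L′ = a ∷ b ∷ c ∷ L
  shifted : OrderPreservingA (suc m) L′
  shifted _ _ (r<ℓ zero _)          = a<b
  shifted _ _ (r<ℓ (suc t) (s≤s t<m)) = subst (λ k → nth L′ k < nth L′ (suc k)) (sym (3*-suc t)) (P _ _ (r<ℓ t t<m))
  shifted _ _ (r<q zero _)          = a<c
  shifted _ _ (r<q (suc t) (s≤s t<m)) = subst (λ k → nth L′ k < nth L′ (suc (suc k))) (sym (3*-suc t)) (P _ _ (r<q t t<m))
  shifted _ _ (q<ℓ zero (s≤s 1≤m))  = link 1≤m
  shifted _ _ (q<ℓ (suc t) (s≤s t<m)) = subst₂ (λ k k′ → nth L′ k < nth L′ k′)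
    (sym (cong (suc ∘ suc) (3*-suc t))) (sym (cong suc (3*-suc (suc t)))) (P _ _ (q<ℓ t t<m))

linkOK : ℕ → List ℕ → Bool
linkOK c (d ∷ e ∷ f ∷ _) = c <ᵇ e
linkOK c _               = true

chainOK-∷ : ∀ a b c L → chainOK (a ∷ b ∷ c ∷ L) ≡ linkOK c L ∧ chainOK L
chainOK-∷ a b c []              = refl
chainOK-∷ a b c (d ∷ [])        = refl
chainOK-∷ a b c (d ∷ e ∷ [])    = refl
chainOK-∷ a b c (d ∷ e ∷ f ∷ L) = refl

length-suc³ : ∀ m (L : List ℕ) → length L ≡ 3 * suc m → length L ≡ suc (suc (suc (3 * m)))
length-suc³ m L lL = trans lL (3*-suc m)

linkOK⇔ : ∀ m c (L : List ℕ) → length L ≡ 3 * m → linkOK c L ≡ true ⇔ (1 ≤ m → c < nth L 1)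
linkOK⇔ zero    c []      _  = mk⇔ (λ _ ()) (λ _ → refl)
linkOK⇔ (suc m) c L       lL with length-suc³ m L lL
linkOK⇔ (suc m) c (d ∷ [])          _ | ()
linkOK⇔ (suc m) c (d ∷ e ∷ [])      _ | ()
linkOK⇔ (suc m) c (d ∷ e ∷ f ∷ L) _ | _ = mk⇔ (λ h _ → <ᵇ-true⇒< c e h) (λ h → <⇒<ᵇ-true (h (s≤s z≤n)))

forestOK : List ℕ → Bool
forestOK F = shrubsOK F ∧ chainOK F

forestOK⇔OrderPreservingA : ∀ n (L : List ℕ) → length L ≡ 3 * n → forestOK L ≡ true ⇔ OrderPreservingA n L
forestOK⇔OrderPreservingA zero    []  _  = mk⇔ (λ { _ _ _ (r<ℓ _ ()) ; _ _ _ (r<q _ ()) ; _ _ _ (q<ℓ _ ()) }) (λ _ → refl)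
forestOK⇔OrderPreservingA (suc m) L   lL with length-suc³ m L lL
forestOK⇔OrderPreservingA (suc m) (a ∷ [])     _ | ()
forestOK⇔OrderPreservingA (suc m) (a ∷ b ∷ []) _ | ()
forestOK⇔OrderPreservingA (suc m) (a ∷ b ∷ c ∷ L) _ | lL′ rewrite chainOK-∷ a b c L = mk⇔ forward backward
  where
  lL : length L ≡ 3 * m
  lL = suc-injective (suc-injective (suc-injective lL′))
  IH = forestOK⇔OrderPreservingA m L lL
  link = linkOK⇔ m c L lL
  forward : (((a <ᵇ b) ∧ (a <ᵇ c) ∧ shrubsOK L) ∧ (linkOK c L ∧ chainOK L)) ≡ true → OrderPreservingA (suc m) (a ∷ b ∷ c ∷ L)
  forward h with ∧-≡true⁻ {(a <ᵇ b) ∧ (a <ᵇ c) ∧ shrubsOK L} h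
  ... | h₁ , h₂ with ∧-≡true⁻ {a <ᵇ b} h₁ | ∧-≡true⁻ {linkOK c L} h₂
  ... | ab , h₃ | lk , ch with ∧-≡true⁻ {a <ᵇ c} h₃
  ... | ac , sh = OrderPreservingA-∷ m a b c L (<ᵇ-true⇒< a b ab) (<ᵇ-true⇒< a c ac) (Equivalence.to link lk) (Equivalence.to IH (cong₂ _∧_ sh ch))
  backward : OrderPreservingA (suc m) (a ∷ b ∷ c ∷ L) → (((a <ᵇ b) ∧ (a <ᵇ c) ∧ shrubsOK L) ∧ (linkOK c L ∧ chainOK L)) ≡ true
  backward P with OrderPreservingA-∷⁻ m a b c L P
  ... | a<b , a<c , lk , P′ rewrite <⇒<ᵇ-true a<b | <⇒<ᵇ-true a<c | Equivalence.from link lk = Equivalence.from IH P′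

LA≡IAF2 : ∀ n → 1 ≤ n → LA n ≡ IAF2 n
LA≡IAF2 n@(suc _) _ = begin
  length (filter (T? ∘ preserves (relsA n)) (bijLabelings (3 * n)))
    ≡⟨ length-filter (preserves (relsA n)) (bijLabelings (3 * n)) ⟩
  count (preserves (relsA n)) (bijLabelings (3 * n))
    ≡⟨ count-cong (bijLabelings (3 * n))
                  (All.map (λ {L} → same {L}) (filter⁺ (T? ∘ isBijLabeling (3 * n)) (length-words (labels (3 * n)) (3 * n)))) ⟩
  count forestOK (bijLabelings (3 * n))
    ≡⟨ length-filter forestOK (bijLabelings (3 * n)) ⟨
  IAF2 n ∎
  where
  open ≡-Reasoning
  same : ∀ {L} → length L ≡ 3 * n → preserves (relsA n) L ≡ forestOK L
  same {L} lL = bool-ext (from forest ∘ to extension) (from extension ∘ to forest)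
    where
    open Equivalence
    extension : preserves (relsA n) L ≡ true ⇔ OrderPreservingA n L
    extension = preserves-relsA⇔ n L
    forest : forestOK L ≡ true ⇔ OrderPreservingA n L
    forest = forestOK⇔OrderPreservingA n L lL

sumFrom1-shift : ∀ n (f g : ℕ → ℕ) → (∀ t → f (suc t) ≡ g t) → sumFrom1 n f ≡ sum (map g (upTo n))
sumFrom1-shift n f g e = trans (sum-map-∘ f suc (upTo n)) (cong sum (map-cong e (upTo n)))

LB-recurrence : ∀ n → LB n ≡ LE n + sumFrom1 n (λ k → ((3 * n + 1) C (3 * (k ∸ 1) + 2)) * LB (k ∸ 1) * LB (n ∸ k))
LB-recurrence n = trans (LB≡zigzagExt n) (trans (recurrenceB n)
  (cong₂ _+_ (sym (LE≡zigzagExt n)) (sym (sumFrom1-shift n _ (termB n) λ t →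
    cong₂ _*_ (cong₂ _*_ (cong₂ _C_ (+1≡suc (3 * n)) (+2≡suc² (3 * t))) (LB≡zigzagExt t)) (LB≡zigzagExt (n ∸ suc t))))))

LS-recurrence : ∀ n → LS n ≡ LA n + sumFrom1 n (λ k → ((3 * n) C (3 * (k ∸ 1) + 2)) * LB (k ∸ 1) * LS (n ∸ k))
LS-recurrence n = trans (LS≡zigzagExt n) (trans (recurrenceS n)
  (cong₂ _+_ (sym (LA≡zigzagExt n)) (sym (sumFrom1-shift n _ (termS n) λ t →
    cong₂ _*_ (cong₂ _*_ (cong (3 * n C_) (+2≡suc² (3 * t))) (LB≡zigzagExt t)) (LS≡zigzagExt (n ∸ suc t))))))

LE-recurrence : ∀ n → 1 ≤ n → LE n ≡ sumFrom1 n (λ k → ((3 * n) C (3 * (k ∸ 1) + 1)) * LE (k ∸ 1) * LB (n ∸ k))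
LE-recurrence n 1≤n = trans (LE≡zigzagExt n) (trans (recurrenceE n 1≤n)
  (sym (sumFrom1-shift n _ (termE n) λ t →
    cong₂ _*_ (cong₂ _*_ (cong (3 * n C_) (+1≡suc (3 * t))) (LE≡zigzagExt t)) (LB≡zigzagExt (n ∸ suc t)))))

LA-recurrence : ∀ n → 1 ≤ n → LA n ≡ sumFrom1 n (λ k → ((3 * n ∸ 1) C (3 * (k ∸ 1) + 1)) * LE (k ∸ 1) * LS (n ∸ k))
LA-recurrence n 1≤n = trans (LA≡zigzagExt n) (trans (recurrenceA n 1≤n)
  (sym (sumFrom1-shift n _ (termA n) λ t →
    cong₂ _*_ (cong₂ _*_ (cong ((3 * n ∸ 1) C_) (+1≡suc (3 * t))) (LE≡zigzagExt t)) (LS≡zigzagExt (n ∸ suc t)))))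

mainTheorem11 : (n : ℕ) → 1 ≤ n →
    (LB n ≡ LE n + sumFrom1 n (λ k → ((3 * n + 1) C (3 * (k ∸ 1) + 2)) * LB (k ∸ 1) * LB (n ∸ k)))
  × (LS n ≡ LA n + sumFrom1 n (λ k → ((3 * n) C (3 * (k ∸ 1) + 2)) * LB (k ∸ 1) * LS (n ∸ k)))
  × (LE n ≡ sumFrom1 n (λ k → ((3 * n) C (3 * (k ∸ 1) + 1)) * LE (k ∸ 1) * LB (n ∸ k)))
  × (LA n ≡ sumFrom1 n (λ k → ((3 * n ∸ 1) C (3 * (k ∸ 1) + 1)) * LE (k ∸ 1) * LS (n ∸ k)))
  × (LA n ≡ IAF2 n)
mainTheorem11 n 1≤n = LB-recurrence n , LS-recurrence n , LE-recurrence n 1≤n , LA-recurrence n 1≤n , LA≡IAF2 n 1≤n
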